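{- Let $n\ge1$ and $k\ge1$ be fixed integers with $k\le n/2$. There exists a tight $(k,k)$-design in $F_2^n$ if and only if there exists a tight $(2k+1)$-design in $F_2^n$.
   Context: $F_2^n$ is the set of binary vectors of length $n$, with Hamming distance $d(x,y)$, and $\langle x,y\rangle:=1-\frac{2d(x,y)}{n}$. The Krawtchouk polynomials $Q_i^{(n)}(t)$ are defined by $Q_0^{(n)}=1$, $Q_1^{(n)}(t)=t$, $ntQ_i^{(n)}(t)=(n-i)Q_{i+1}^{(n)}(t)+iQ_{i-1}^{(n)}(t)$ for $1\le i\le n-1$. For a nonempty $C\subseteq F_2^n$ the moments are $M_i(C):=\sum_{x,y\in C}Q_i^{(n)}(\langle x,y\rangle)$ (over all ordered pairs, including $x=y$). $C$ is an $m$-design ($1\le m\le n$) if $M_i(C)=0$ for $i=1,\dots,m$ (equivalently, a binary orthogonal array of strength $m$: any $m$ columns of the codeword matrix contain each $m$-tuple equally often). $C$ is a $(k,k)$-design if $M_i(C)=0$ for $i=2,4,\dots,2k$. A $(k,k)$-design is tight if its cardinality equals $\sum_{i=0}^k\binom{n-1}{i}$. A $(2k+1)$-design is tight if its cardinality equals the Rao bound $2\sum_{i=0}^k\binom{n-1}{i}$. -}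

module Defs where

open import Data.Bool using (Bool; true; false; _≟_)
open import Data.Nat as ℕ using (ℕ; zero; suc; _≤_)
open import Data.Integer using (+_)
open import Data.Rational using (ℚ; 0ℚ; 1ℚ; _/_; _+_; _-_; _*_)
open import Data.Vec using (Vec; []; _∷_)
open import Data.List using (List; []; _∷_; length)
open import Data.List.Relation.Unary.Unique.Propositional using (Unique)
open import Data.Nat.Combinatorics using (_C_)
open import Relation.Binary.PropositionalEquality using (_≡_; _≢_)
open import Relation.Nullary using (yes; no)
open import Data.Product using (_×_)

ℕ→ℚ : ℕ → ℚ
ℕ→ℚ m = + m / 1

-- p / m, with the (never used) convention p / 0 = 0
_÷ℕ_ : ℚ → ℕ → ℚ
p ÷ℕ zero    = 0ℚ
p ÷ℕ (suc m) = p * (+ 1 / suc m)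

hamming : ∀ {n} → Vec Bool n → Vec Bool n → ℕ
hamming []       []       = 0
hamming (a ∷ xs) (b ∷ ys) with a ≟ b
... | yes _ = hamming xs ys
... | no  _ = suc (hamming xs ys)

inner : ∀ {n} → Vec Bool n → Vec Bool n → ℚ
inner {n} x y = 1ℚ - (ℕ→ℚ (2 ℕ.* hamming x y) ÷ℕ n)

-- Krawtchouk polynomials Q_i^{(n)}(t):
-- Q_0 = 1, Q_1 = t, Q_{i+1} = (n t Q_i - i Q_{i-1}) / (n - i)  for 1 ≤ i ≤ n-1.
-- (For i ≥ n the recurrence is not defined in the paper; those values are never used.)
Q : ℕ → ℕ → ℚ → ℚ
Q n zero          t = 1ℚ
Q n (suc zero)    t = t
Q n (suc (suc i)) t =
  ((ℕ→ℚ n * t * Q n (suc i) t) - (ℕ→ℚ (suc i) * Q n i t)) ÷ℕ (n ℕ.∸ suc i)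

sumℚ : List ℚ → ℚ
sumℚ []       = 0ℚ
sumℚ (q ∷ qs) = q + sumℚ qs

moment : ∀ {n} → ℕ → List (Vec Bool n) → ℚ
moment {n} i C = sumℚ (Data.List.concatMap (λ x → Data.List.map (λ y → Q n i (inner x y)) C) C)

-- a code: a nonempty subset of F_2^n, represented as a duplicate-free nonempty list
IsCode : ∀ {n} → List (Vec Bool n) → Set
IsCode C = Unique C × C ≢ []

-- m-design (1 ≤ m ≤ n): M_i(C) = 0 for i = 1..m.
-- (Indices i > n are ignored; this only matters for m = n+1.)
IsDesign : ∀ {n} → ℕ → List (Vec Bool n) → Set
IsDesign {n} m C = ∀ i → 1 ≤ i → i ≤ m → i ≤ n → moment i C ≡ 0ℚ

IsKKDesign : ∀ {n} → ℕ → List (Vec Bool n) → Set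
IsKKDesign k C = ∀ j → 1 ≤ j → j ≤ k → moment (2 ℕ.* j) C ≡ 0ℚ

binomSum : ℕ → ℕ → ℕ
binomSum n zero    = (n ℕ.∸ 1) C 0
binomSum n (suc k) = binomSum n k ℕ.+ ((n ℕ.∸ 1) C suc k)

TightKKDesign : ∀ {n} → ℕ → List (Vec Bool n) → Set
TightKKDesign {n} k C = IsCode C × IsKKDesign k C × length C ≡ binomSum n k

-- tight (2k+1)-design: cardinality equals the Rao bound 2 Σ_{i=0}^k binom(n-1,i)
TightOddDesign : ∀ {n} → ℕ → List (Vec Bool n) → Set
TightOddDesign {n} k C =
  IsCode C × IsDesign (suc (2 ℕ.* k)) C × length C ≡ 2 ℕ.* binomSum n k

-- Both directions go through the Fourier transform f̂_C(S) = Σ_{x ∈ C} (−1)^{S·x} of a code C.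
-- (n choose i) Q_i(⟨x,y⟩) is the Krawtchouk number Σ_{|S| = i} (−1)^{S·(x+y)}, since both satisfy
-- the same three-term recurrence in i; hence (n choose i) M_i(C) = Σ_{|S| = i} f̂_C(S)², and
-- M_i(C) = 0 exactly when f̂_C vanishes on the vectors of weight i.
-- If D is a tight (2k+1)-design, its words with first coordinate 0 form a tight (k,k)-design:
-- twice their transform at S is f̂_D(S) + f̂_D(S + e₁), and at S = 0 this gives the size |D|/2.
-- Conversely, if C is a tight (k,k)-design then C ∪ (C + 𝟙) is a tight (2k+1)-design, because
-- f̂_{C+𝟙}(S) = (−1)^{|S|} f̂_C(S); it only remains to see that C contains no antipodal pair.
-- Let 𝒜 be the |C| vectors of weight k, k − 2, k − 4, … and G(x,y) = Σ_{A ∈ 𝒜} χ_A(x) χ_A(y).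
-- Then Σ_{x,y ∈ C} G(x,y)² = Σ_{A,B ∈ 𝒜} f̂_C(A + B)² = |C|³, as A + B has even weight in
-- [2, 2k] when A ≠ B. The diagonal x = y alone contributes |C|³, and G(x, x + 𝟙) = ±|C|,
-- so an antipodal pair in C would add at least |C|² more.

module Submission where

open import Data.Bool using (Bool; true; false; not; _xor_; _∧_)
open import Data.Vec using (Vec; []; _∷_; head; zipWith; replicate)
open import Data.List using (List; []; _∷_; _++_; map; concatMap; length; filter)
open import Data.List.Membership.Propositional using (_∈_)
open import Data.List.Membership.Propositional.Properties
  using (∈-map⁺; ∈-map⁻; ∈-++⁺ˡ; ∈-++⁺ʳ; ∈-++⁻)
open import Data.List.Relation.Unary.Any using (here; there)
open import Data.List.Relation.Unary.Unique.Propositional using (Unique; []; _∷_)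
import Data.List.Relation.Unary.Unique.Propositional.Properties as Unique
open import Data.Product using (Σ; _×_; _,_; ∃-syntax; uncurry)
open import Data.Sum using (_⊎_; inj₁; inj₂)
open import Data.Empty using (⊥; ⊥-elim)
open import Relation.Nullary using (¬_)
open import Relation.Binary.PropositionalEquality
open import Defs

module FiniteSums where

  open import Data.Integer using (ℤ; +_; -[1+_]; ∣_∣; 0ℤ; _+_; _*_)
  open import Data.Integer.Properties
  open import Data.Integer.Tactic.RingSolver using (solve-∀)
  open import Data.Nat as ℕ using (ℕ; _<_; _≤_; z≤n)
  import Data.Nat.Properties as ℕ
  open import Data.List.Relation.Unary.All using (lookup)
  open import Data.Sum using (reduce)
  open import Function using (_∘_)
  open ≡-Reasoning

  private variable
    A B : Set
    as : List A
    f g : A → ℤ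

  ∑ : List A → (A → ℤ) → ℤ
  ∑ []       f = 0ℤ
  ∑ (a ∷ as) f = f a + ∑ as f

  ∑-cong : (∀ {a} → a ∈ as → f a ≡ g a) → ∑ as f ≡ ∑ as g
  ∑-cong {as = []}     f≡g = refl
  ∑-cong {as = a ∷ as} f≡g = cong₂ _+_ (f≡g (here refl)) (∑-cong (f≡g ∘ there))

  ∑-++ : ∀ (as bs : List A) f → ∑ (as ++ bs) f ≡ ∑ as f + ∑ bs f
  ∑-++ []       bs f = sym (+-identityˡ _)
  ∑-++ (a ∷ as) bs f = trans (cong (λ s → f a + s) (∑-++ as bs f)) (sym (+-assoc (f a) _ _))

  ∑-map : ∀ (h : A → B) as (f : B → ℤ) → ∑ (map h as) f ≡ ∑ as (λ a → f (h a))
  ∑-map h []       f = refl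
  ∑-map h (a ∷ as) f = cong (λ s → f (h a) + s) (∑-map h as f)

  ∑-+ : ∀ (as : List A) f g → ∑ as (λ a → f a + g a) ≡ ∑ as f + ∑ as g
  ∑-+ []       f g = refl
  ∑-+ (a ∷ as) f g = begin
    f a + g a + ∑ as (λ a → f a + g a) ≡⟨ cong (λ s → f a + g a + s) (∑-+ as f g) ⟩
    f a + g a + (∑ as f + ∑ as g)       ≡⟨ interchange (f a) (g a) (∑ as f) (∑ as g) ⟩
    f a + ∑ as f + (g a + ∑ as g)       ∎
    where
    interchange : ∀ w x y z → w + x + (y + z) ≡ w + y + (x + z)
    interchange = solve-∀

  ∑-*ˡ : ∀ (as : List A) c f → ∑ as (λ a → c * f a) ≡ c * ∑ as f
  ∑-*ˡ []       c f = sym (*-zeroʳ c)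
  ∑-*ˡ (a ∷ as) c f = trans (cong (λ s → c * f a + s) (∑-*ˡ as c f)) (sym (*-distribˡ-+ c (f a) _))

  ∑-zero : (∀ {a} → a ∈ as → f a ≡ 0ℤ) → ∑ as f ≡ 0ℤ
  ∑-zero {as = []}     _   = refl
  ∑-zero {as = a ∷ as} f≡0 = cong₂ _+_ (f≡0 (here refl)) (∑-zero (f≡0 ∘ there))

  ∑-swap : ∀ (as : List A) (bs : List B) (f : A → B → ℤ) →
           ∑ as (λ a → ∑ bs (f a)) ≡ ∑ bs (λ b → ∑ as (λ a → f a b))
  ∑-swap []       bs f = sym (∑-zero {as = bs} (λ _ → refl))
  ∑-swap (a ∷ as) bs f = trans (cong (λ s → ∑ bs (f a) + s) (∑-swap as bs f))
                               (sym (∑-+ bs (f a) (λ b → ∑ as (λ a → f a b))))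

  ∑-*-∑ : ∀ (as : List A) (bs : List B) (f : A → ℤ) (g : B → ℤ) →
          ∑ as f * ∑ bs g ≡ ∑ as (λ a → ∑ bs (λ b → f a * g b))
  ∑-*-∑ as bs f g = begin
    ∑ as f * ∑ bs g
      ≡⟨ *-comm (∑ as f) _ ⟩
    ∑ bs g * ∑ as f
      ≡⟨ ∑-*ˡ as (∑ bs g) f ⟨
    ∑ as (λ a → ∑ bs g * f a)
      ≡⟨ ∑-cong {as = as} (λ {a} _ → trans (*-comm _ (f a)) (sym (∑-*ˡ bs (f a) g))) ⟩
    ∑ as (λ a → ∑ bs (λ b → f a * g b)) ∎

  ∑-const : ∀ (as : List A) c → ∑ as (λ _ → c) ≡ + length as * c
  ∑-const []       c = sym (*-zeroˡ c)
  ∑-const (a ∷ as) c = begin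
    c + ∑ as (λ _ → c)          ≡⟨ cong (λ s → c + s) (∑-const as c) ⟩
    c + + length as * c         ≡⟨ cong (λ s → s + + length as * c) (*-identityˡ c) ⟨
    + 1 * c + + length as * c   ≡⟨ *-distribʳ-+ c (+ 1) (+ length as) ⟨
    (+ 1 + + length as) * c     ∎

  ∑-unique-support : ∀ {a} → Unique as → a ∈ as →
                     (∀ {b} → b ∈ as → b ≢ a → f b ≡ 0ℤ) → ∑ as f ≡ f a
  ∑-unique-support {as = b ∷ as} {f} (b∉as ∷ _) (here refl) off =
    trans (cong (λ s → f b + s) (∑-zero (λ b′∈ → off (there b′∈) (λ { refl → lookup b∉as b′∈ refl }))))
          (+-identityʳ (f b))
  ∑-unique-support {as = b ∷ as} {f} (b∉as ∷ as-unique) (there a∈) off =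
    trans (cong₂ _+_ (off (here refl) (λ { refl → lookup b∉as a∈ refl }))
                     (∑-unique-support as-unique a∈ (off ∘ there)))
          (+-identityˡ _)

  ∑ℕ : List A → (A → ℕ) → ℕ
  ∑ℕ []       f = 0
  ∑ℕ (a ∷ as) f = f a ℕ.+ ∑ℕ as f

  pos-∑ℕ : ∀ (as : List A) (f : A → ℕ) → + ∑ℕ as f ≡ ∑ as (λ a → + f a)
  pos-∑ℕ []       f = refl
  pos-∑ℕ (a ∷ as) f = cong (λ s → + f a + s) (pos-∑ℕ as f)

  ∑ℕ-const : ∀ (as : List A) c → ∑ℕ as (λ _ → c) ≡ length as ℕ.* c
  ∑ℕ-const []       c = refl
  ∑ℕ-const (a ∷ as) c = cong (c ℕ.+_) (∑ℕ-const as c)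

  ∑ℕ≡0⇒≡0 : ∀ {as : List A} {a} (f : A → ℕ) → ∑ℕ as f ≡ 0 → a ∈ as → f a ≡ 0
  ∑ℕ≡0⇒≡0 {as = b ∷ as} f ∑≡0 (here refl) = ℕ.m+n≡0⇒m≡0 (f b) ∑≡0
  ∑ℕ≡0⇒≡0 {as = b ∷ as} f ∑≡0 (there a∈)  = ∑ℕ≡0⇒≡0 f (ℕ.m+n≡0⇒n≡0 (f b) ∑≡0) a∈

  ∈⇒≤∑ℕ : ∀ {as : List A} {a} (f : A → ℕ) → a ∈ as → f a ≤ ∑ℕ as f
  ∈⇒≤∑ℕ {as = b ∷ as} f (here refl) = ℕ.m≤m+n (f b) _
  ∈⇒≤∑ℕ {as = b ∷ as} f (there a∈)  = ℕ.≤-trans (∈⇒≤∑ℕ f a∈) (ℕ.m≤n+m _ (f b))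

  ∈-distinct⇒≤∑ℕ : ∀ {as : List A} {a b} (f : A → ℕ) → a ∈ as → b ∈ as → a ≢ b →
                   f a ℕ.+ f b ≤ ∑ℕ as f
  ∈-distinct⇒≤∑ℕ f (here refl) (here refl) a≢b = ⊥-elim (a≢b refl)
  ∈-distinct⇒≤∑ℕ {as = c ∷ as} f (here refl) (there b∈) _ = ℕ.+-monoʳ-≤ (f c) (∈⇒≤∑ℕ f b∈)
  ∈-distinct⇒≤∑ℕ {as = c ∷ as} {a} f (there a∈) (here refl) _ =
    ℕ.≤-trans (ℕ.≤-reflexive (ℕ.+-comm (f a) (f c))) (ℕ.+-monoʳ-≤ (f c) (∈⇒≤∑ℕ f a∈))
  ∈-distinct⇒≤∑ℕ {as = c ∷ as} f (there a∈) (there b∈) a≢b =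
    ℕ.≤-trans (∈-distinct⇒≤∑ℕ f a∈ b∈ a≢b) (ℕ.m≤n+m _ (f c))

  ∑ℕ-mono-≤ : ∀ {as : List A} (f g : A → ℕ) →
              (∀ {a} → a ∈ as → f a ≤ g a) → ∑ℕ as f ≤ ∑ℕ as g
  ∑ℕ-mono-≤ {as = []}     f g f≤g = z≤n
  ∑ℕ-mono-≤ {as = a ∷ as} f g f≤g = ℕ.+-mono-≤ (f≤g (here refl)) (∑ℕ-mono-≤ f g (f≤g ∘ there))

  ∑ℕ-mono-< : ∀ {as : List A} {a} (f g : A → ℕ) →
              (∀ {b} → b ∈ as → f b ≤ g b) → a ∈ as → f a < g a → ∑ℕ as f < ∑ℕ as g
  ∑ℕ-mono-< f g f≤g (here refl) fa<ga = ℕ.+-mono-<-≤ fa<ga (∑ℕ-mono-≤ f g (f≤g ∘ there))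
  ∑ℕ-mono-< f g f≤g (there a∈)  fa<ga =
    ℕ.+-mono-≤-< (f≤g (here refl)) (∑ℕ-mono-< f g (f≤g ∘ there) a∈ fa<ga)

  ∣_∣² : ℤ → ℕ
  ∣ i ∣² = ∣ i ∣ ℕ.* ∣ i ∣

  i*i≡∣i∣² : ∀ i → i * i ≡ + ∣ i ∣²
  i*i≡∣i∣² (+ n)    = sym (pos-* n n)
  i*i≡∣i∣² -[1+ n ] = refl

  ∑-squares≡0 : ∀ {as : List A} {a} (h : A → ℤ) →
                ∑ as (λ a → h a * h a) ≡ 0ℤ → a ∈ as → h a ≡ 0ℤ
  ∑-squares≡0 {as = as} {a} h ∑≡0 a∈ = reduce (i*j≡0⇒i≡0∨j≡0 (h a) (begin
    h a * h a   ≡⟨ i*i≡∣i∣² (h a) ⟩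
    + ∣ h a ∣²  ≡⟨ cong +_ (∑ℕ≡0⇒≡0 (λ a → ∣ h a ∣²) ∑ℕ≡0 a∈) ⟩
    0ℤ          ∎))
    where
    ∑ℕ≡0 : ∑ℕ as (λ a → ∣ h a ∣²) ≡ 0
    ∑ℕ≡0 = +-injective (trans (pos-∑ℕ as (λ a → ∣ h a ∣²))
                              (trans (sym (∑-cong {as = as} (λ {a} _ → i*i≡∣i∣² (h a)))) ∑≡0))


module IntegersInRationals where

  open import Data.Nat as ℕ using (ℕ; suc; NonZero)
  open import Data.Integer as ℤ using (ℤ; +_)
  import Data.Integer.Properties as ℤ
  open import Data.Integer.Tactic.RingSolver using (solve-∀)
  open import Data.Nat.Tactic.RingSolver using () renaming (solve-∀ to ℕ-solve-∀)
  open import Data.Rational using (ℚ; 1ℚ; _/_; toℚᵘ; _+_; _*_; -_; _-_)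
  open import Data.Rational.Properties
  open import Data.Rational.Unnormalised as ℚᵘ using (ℚᵘ; mkℚᵘ; *≡*)
  import Data.Rational.Unnormalised.Properties as ℚᵘ
  open import Algebra.Bundles using (CommutativeRing)
  import Algebra.Properties.CommutativeSemigroup as CommutativeSemigroup

  ι : ℤ → ℚ
  ι z = z / 1

  private
    toℚᵘ-ι : ∀ z → toℚᵘ (ι z) ℚᵘ.≃ mkℚᵘ z 0
    toℚᵘ-ι z = toℚᵘ-fromℚᵘ (mkℚᵘ z 0)

  ι-+ : ∀ a b → ι (a ℤ.+ b) ≡ ι a + ι b
  ι-+ a b = toℚᵘ-injective (begin
    toℚᵘ (ι (a ℤ.+ b))                ≈⟨ toℚᵘ-ι (a ℤ.+ b) ⟩
    mkℚᵘ (a ℤ.+ b) 0                  ≈⟨ *≡* (cross-multiplied a b) ⟩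
    mkℚᵘ a 0 ℚᵘ.+ mkℚᵘ b 0            ≈⟨ ℚᵘ.+-cong (toℚᵘ-ι a) (toℚᵘ-ι b) ⟨
    toℚᵘ (ι a) ℚᵘ.+ toℚᵘ (ι b)        ≈⟨ toℚᵘ-homo-+ (ι a) (ι b) ⟨
    toℚᵘ (ι a + ι b)                  ∎)
    where
    open ℚᵘ.≃-Reasoning
    cross-multiplied : ∀ a b → (a ℤ.+ b) ℤ.* + 1 ≡ (a ℤ.* + 1 ℤ.+ b ℤ.* + 1) ℤ.* + 1
    cross-multiplied = solve-∀

  ι-* : ∀ a b → ι (a ℤ.* b) ≡ ι a * ι b
  ι-* a b = toℚᵘ-injective (begin
    toℚᵘ (ι (a ℤ.* b))                ≈⟨ toℚᵘ-ι (a ℤ.* b) ⟩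
    mkℚᵘ (a ℤ.* b) 0                  ≈⟨ ℚᵘ.*-cong (toℚᵘ-ι a) (toℚᵘ-ι b) ⟨
    toℚᵘ (ι a) ℚᵘ.* toℚᵘ (ι b)        ≈⟨ toℚᵘ-homo-* (ι a) (ι b) ⟨
    toℚᵘ (ι a * ι b)                  ∎)
    where open ℚᵘ.≃-Reasoning

  ι-neg : ∀ a → ι (ℤ.- a) ≡ - ι a
  ι-neg a = toℚᵘ-injective (begin
    toℚᵘ (ι (ℤ.- a))    ≈⟨ toℚᵘ-ι (ℤ.- a) ⟩
    ℚᵘ.- mkℚᵘ a 0       ≈⟨ ℚᵘ.-‿cong (toℚᵘ-ι a) ⟨
    ℚᵘ.- toℚᵘ (ι a)     ≈⟨ toℚᵘ-homo‿- (ι a) ⟨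
    toℚᵘ (- ι a)        ∎)
    where open ℚᵘ.≃-Reasoning

  ι-minus : ∀ a b → ι (a ℤ.- b) ≡ ι a - ι b
  ι-minus a b = trans (ι-+ a (ℤ.- b)) (cong (λ q → ι a + q) (ι-neg b))

  ι-injective : ∀ {a b} → ι a ≡ ι b → a ≡ b
  ι-injective {a} {b} ιa≡ιb with ℚᵘ.≃-trans (ℚᵘ.≃-sym (toℚᵘ-ι a))
                                            (ℚᵘ.≃-trans (toℚᵘ-cong ιa≡ιb) (toℚᵘ-ι b))
  ... | *≡* a*1≡b*1 = trans (sym (ℤ.*-identityʳ a)) (trans a*1≡b*1 (ℤ.*-identityʳ b))

  ℕ→ℚ-* : ∀ a b → ℕ→ℚ (a ℕ.* b) ≡ ℕ→ℚ a * ℕ→ℚ b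
  ℕ→ℚ-* a b = trans (cong ι (ℤ.pos-* a b)) (ι-* (+ a) (+ b))

  ÷ℕ-*-inverse : ∀ p n .{{_ : NonZero n}} → (p ÷ℕ n) * ℕ→ℚ n ≡ p
  ÷ℕ-*-inverse p (suc m) = begin
    p * (+ 1 / suc m) * ℕ→ℚ (suc m)   ≡⟨ *-assoc p _ _ ⟩
    p * ((+ 1 / suc m) * ℕ→ℚ (suc m)) ≡⟨ cong (p *_) inverse ⟩
    p * 1ℚ                            ≡⟨ *-identityʳ p ⟩
    p                                 ∎
    where
    open ≡-Reasoning
    denominators : ∀ m → (m ℕ.+ 0) ℕ.* 1 ≡ m ℕ.* 1 ℕ.+ 0
    denominators = ℕ-solve-∀
    inverse : (+ 1 / suc m) * ℕ→ℚ (suc m) ≡ 1ℚ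
    inverse = toℚᵘ-injective (ℚᵘ.≃-trans (toℚᵘ-homo-* (+ 1 / suc m) (ℕ→ℚ (suc m)))
      (ℚᵘ.≃-trans (ℚᵘ.*-cong (toℚᵘ-fromℚᵘ (mkℚᵘ (+ 1) m)) (toℚᵘ-ι (+ suc m)))
                  (*≡* (cong (λ k → + suc k) (denominators m)))))

  ℕ→ℚ-*-cancelˡ : ∀ n .{{_ : NonZero n}} {p q} → ℕ→ℚ n * p ≡ ℕ→ℚ n * q → p ≡ q
  ℕ→ℚ-*-cancelˡ n {p} {q} np≡nq = begin
    p                      ≡⟨ ÷ℕ-*-inverse p n ⟨
    (p ÷ℕ n) * ℕ→ℚ n       ≡⟨ ÷ℕ-comm p ⟩
    (ℕ→ℚ n * p) ÷ℕ n       ≡⟨ cong (_÷ℕ n) np≡nq ⟩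
    (ℕ→ℚ n * q) ÷ℕ n       ≡⟨ ÷ℕ-comm q ⟨
    (q ÷ℕ n) * ℕ→ℚ n       ≡⟨ ÷ℕ-*-inverse q n ⟩
    q                      ∎
    where
    open ≡-Reasoning
    ÷ℕ-comm : ∀ {n} .{{_ : NonZero n}} r → (r ÷ℕ n) * ℕ→ℚ n ≡ (ℕ→ℚ n * r) ÷ℕ n
    ÷ℕ-comm {suc m} r = xy∙z≈zx∙y r (+ 1 / suc m) (ℕ→ℚ (suc m))
      where open CommutativeSemigroup (CommutativeRing.*-commutativeSemigroup +-*-commutativeRing)


open FiniteSums
open IntegersInRationals

module Binomials where

  open import Data.Nat
  open import Data.Nat.Properties
  open import Data.Nat.Combinatorics using (_C_; nC1≡n; nCk+nC[k+1]≡[n+1]C[k+1])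
  open import Data.Nat.Tactic.RingSolver using (solve-∀)
  open ≡-Reasoning

  pascal : ∀ n k → suc n C suc k ≡ n C k + n C suc k
  pascal n k = sym (nCk+nC[k+1]≡[n+1]C[k+1] n k)

  nCk>0 : ∀ {n k} → k ≤ n → 0 < n C k
  nCk>0 {k = zero} _ = z<s
  nCk>0 {suc n} {suc k} (s≤s k≤n) = subst (0 <_) (sym (pascal n k)) (<-≤-trans (nCk>0 k≤n) (m≤m+n _ _))

  C-absorption : ∀ n k → suc k * (n C suc k) ≡ (n ∸ k) * (n C k)
  C-absorption n k = begin
    suc k * (n C suc k)                             ≡⟨ m+n∸n≡m _ (k * (n C k)) ⟨
    suc k * (n C suc k) + k * (n C k) ∸ k * (n C k) ≡⟨ cong (_∸ k * (n C k)) (absorption-+ n k) ⟩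
    n * (n C k) ∸ k * (n C k)                       ≡⟨ *-distribʳ-∸ (n C k) n k ⟨
    (n ∸ k) * (n C k)                               ∎
    where
    absorption-+ : ∀ n k → suc k * (n C suc k) + k * (n C k) ≡ n * (n C k)
    absorption-+ zero    zero    = refl
    absorption-+ zero    (suc k) = cong₂ _+_ (*-zeroʳ (2 + k)) (*-zeroʳ (suc k))
    absorption-+ (suc n) zero    = trans (cong (λ c → 1 * c + 0) (nC1≡n (suc n))) (units (suc n))
      where
      units : ∀ m → 1 * m + 0 ≡ m * 1
      units = solve-∀
    absorption-+ (suc n) (suc k) = begin
      (2 + k) * (suc n C (2 + k)) + (1 + k) * (suc n C suc k)
        ≡⟨ cong₂ (λ c c′ → (2 + k) * c + (1 + k) * c′) (pascal n (suc k)) (pascal n k) ⟩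
      (2 + k) * (a + b) + (1 + k) * (c + a)
        ≡⟨ regroup k a b c ⟩
      ((2 + k) * b + (1 + k) * a) + (((1 + k) * a + k * c) + a + c)
        ≡⟨ cong₂ (λ x y → x + (y + a + c)) (absorption-+ n (suc k)) (absorption-+ n k) ⟩
      n * a + (n * c + a + c)
        ≡⟨ collect n a c ⟩
      (1 + n) * (c + a)
        ≡⟨ cong ((1 + n) *_) (pascal n k) ⟨
      (1 + n) * (suc n C suc k) ∎
      where
      a = n C suc k
      b = n C (2 + k)
      c = n C k
      regroup : ∀ k a b c → (2 + k) * (a + b) + (1 + k) * (c + a)
                            ≡ ((2 + k) * b + (1 + k) * a) + (((1 + k) * a + k * c) + a + c)
      regroup = solve-∀
      collect : ∀ n a c → n * a + (n * c + a + c) ≡ (1 + n) * (c + a)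
      collect = solve-∀

  binomSum-pascal : ∀ m k → binomSum (2 + m) (suc k) ≡ binomSum (suc m) (suc k) + binomSum (suc m) k
  binomSum-pascal m zero = begin
    1 + suc m C 1         ≡⟨ cong (1 +_) (pascal m 0) ⟩
    1 + (1 + m C 1)       ≡⟨ +-comm 1 (1 + m C 1) ⟩
    (1 + m C 1) + 1       ∎
  binomSum-pascal m (suc k) = begin
    binomSum (2 + m) (suc k) + suc m C (2 + k)
      ≡⟨ cong₂ _+_ (binomSum-pascal m k) (pascal m (suc k)) ⟩
    (binomSum (suc m) (suc k) + binomSum (suc m) k) + (m C suc k + m C (2 + k))
      ≡⟨ regroup (binomSum (suc m) (suc k)) (binomSum (suc m) k) (m C suc k) (m C (2 + k)) ⟩
    (binomSum (suc m) (suc k) + m C (2 + k)) + (binomSum (suc m) k + m C suc k) ∎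
    where
    regroup : ∀ a b c d → (a + b) + (c + d) ≡ (a + d) + (b + c)
    regroup = solve-∀

  binomSum-1 : ∀ k → binomSum 1 k ≡ 1
  binomSum-1 zero    = refl
  binomSum-1 (suc k) = trans (+-identityʳ (binomSum 1 k)) (binomSum-1 k)

  binomSum>0 : ∀ n k → 0 < binomSum n k
  binomSum>0 n zero    = z<s
  binomSum>0 n (suc k) = <-≤-trans (binomSum>0 n k) (m≤m+n _ _)

module Characters where

  open import Data.Nat as ℕ using (ℕ; zero; suc)
  import Data.Nat.Properties as ℕ
  open import Data.Nat.Tactic.RingSolver using () renaming (solve-∀ to ℕ-solve-∀)
  open import Data.Integer using (ℤ; +_; 0ℤ; 1ℤ; -1ℤ; _+_; _*_; _-_; _^_)
  open import Data.Integer.Properties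
  open import Data.Integer.Tactic.RingSolver using (solve-∀)
  open import Data.Bool.Properties using (not-involutive; not-¬)
  import Data.Vec as Vec
  open ≡-Reasoning

  private variable
    n : ℕ

  sign : Bool → ℤ
  sign false = 1ℤ
  sign true  = -1ℤ

  χ : Vec Bool n → Vec Bool n → ℤ
  χ []          []      = 1ℤ
  χ (false ∷ S) (_ ∷ x) = χ S x
  χ (true  ∷ S) (b ∷ x) = sign b * χ S x

  weight : Vec Bool n → ℕ
  weight []          = 0
  weight (false ∷ x) = weight x
  weight (true  ∷ x) = suc (weight x)

  _⊕_ : Vec Bool n → Vec Bool n → Vec Bool n
  _⊕_ = zipWith _xor_

  zeros : ∀ n → Vec Bool n
  zeros n = replicate n false

  weight-zeros : ∀ n → weight (zeros n) ≡ 0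
  weight-zeros zero    = refl
  weight-zeros (suc n) = weight-zeros n

  hamming≡weight-⊕ : ∀ (x y : Vec Bool n) → hamming x y ≡ weight (x ⊕ y)
  hamming≡weight-⊕ []          []          = refl
  hamming≡weight-⊕ (false ∷ x) (false ∷ y) = hamming≡weight-⊕ x y
  hamming≡weight-⊕ (false ∷ x) (true  ∷ y) = cong suc (hamming≡weight-⊕ x y)
  hamming≡weight-⊕ (true  ∷ x) (false ∷ y) = cong suc (hamming≡weight-⊕ x y)
  hamming≡weight-⊕ (true  ∷ x) (true  ∷ y) = hamming≡weight-⊕ x y

  sign-xor : ∀ a b → sign (a xor b) ≡ sign a * sign b
  sign-xor false false = refl
  sign-xor false true  = refl
  sign-xor true  false = refl
  sign-xor true  true  = refl

  sign*sign : ∀ b → sign b * sign b ≡ 1ℤ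
  sign*sign false = refl
  sign*sign true  = refl

  χ-⊕ʳ : ∀ (S x y : Vec Bool n) → χ S (x ⊕ y) ≡ χ S x * χ S y
  χ-⊕ʳ []          []      []      = refl
  χ-⊕ʳ (false ∷ S) (_ ∷ x) (_ ∷ y) = χ-⊕ʳ S x y
  χ-⊕ʳ (true  ∷ S) (a ∷ x) (b ∷ y) = begin
    sign (a xor b) * χ S (x ⊕ y)          ≡⟨ cong₂ _*_ (sign-xor a b) (χ-⊕ʳ S x y) ⟩
    (sign a * sign b) * (χ S x * χ S y)   ≡⟨ interchange (sign a) (sign b) (χ S x) (χ S y) ⟩
    (sign a * χ S x) * (sign b * χ S y)   ∎
    where
    interchange : ∀ p q r s → (p * q) * (r * s) ≡ (p * r) * (q * s)
    interchange = solve-∀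

  χ-comm : ∀ (S x : Vec Bool n) → χ S x ≡ χ x S
  χ-comm []          []          = refl
  χ-comm (false ∷ S) (false ∷ x) = χ-comm S x
  χ-comm (false ∷ S) (true  ∷ x) = trans (χ-comm S x) (sym (*-identityˡ _))
  χ-comm (true  ∷ S) (false ∷ x) = trans (*-identityˡ _) (χ-comm S x)
  χ-comm (true  ∷ S) (true  ∷ x) = cong (-1ℤ *_) (χ-comm S x)

  χ-⊕ˡ : ∀ (A B x : Vec Bool n) → χ (A ⊕ B) x ≡ χ A x * χ B x
  χ-⊕ˡ A B x = trans (χ-comm (A ⊕ B) x)
                (trans (χ-⊕ʳ x A B) (cong₂ _*_ (χ-comm x A) (χ-comm x B)))

  ⊕-self : ∀ (x : Vec Bool n) → x ⊕ x ≡ zeros n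
  ⊕-self []          = refl
  ⊕-self (false ∷ x) = cong (false ∷_) (⊕-self x)
  ⊕-self (true  ∷ x) = cong (false ∷_) (⊕-self x)

  ⊕-weight≡0⇒≡ : ∀ (x y : Vec Bool n) → weight (x ⊕ y) ≡ 0 → x ≡ y
  ⊕-weight≡0⇒≡ []          []          _ = refl
  ⊕-weight≡0⇒≡ (false ∷ x) (false ∷ y) w≡0 = cong (false ∷_) (⊕-weight≡0⇒≡ x y w≡0)
  ⊕-weight≡0⇒≡ (true  ∷ x) (true  ∷ y) w≡0 = cong (true ∷_) (⊕-weight≡0⇒≡ x y w≡0)
  ⊕-weight≡0⇒≡ (false ∷ x) (true  ∷ y) ()
  ⊕-weight≡0⇒≡ (true  ∷ x) (false ∷ y) ()

  χ-zerosʳ : ∀ (S : Vec Bool n) → χ S (zeros n) ≡ 1ℤ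
  χ-zerosʳ []          = refl
  χ-zerosʳ (false ∷ S) = χ-zerosʳ S
  χ-zerosʳ (true  ∷ S) = trans (*-identityˡ _) (χ-zerosʳ S)

  χ-zerosˡ : ∀ (x : Vec Bool n) → χ (zeros n) x ≡ 1ℤ
  χ-zerosˡ x = trans (χ-comm (zeros _) x) (χ-zerosʳ x)

  χ-square : ∀ (S x : Vec Bool n) → χ S x * χ S x ≡ 1ℤ
  χ-square S x = trans (sym (χ-⊕ʳ S x x)) (trans (cong (χ S) (⊕-self x)) (χ-zerosʳ S))

  weight-⊕ : ∀ (A B : Vec Bool n) →
             weight (A ⊕ B) ℕ.+ 2 ℕ.* weight (zipWith _∧_ A B) ≡ weight A ℕ.+ weight B
  weight-⊕ []          []          = refl
  weight-⊕ (false ∷ A) (false ∷ B) = weight-⊕ A B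
  weight-⊕ (false ∷ A) (true  ∷ B) = trans (cong suc (weight-⊕ A B)) (sym (ℕ.+-suc (weight A) (weight B)))
  weight-⊕ (true  ∷ A) (false ∷ B) = cong suc (weight-⊕ A B)
  weight-⊕ (true  ∷ A) (true  ∷ B) = begin
    w ℕ.+ 2 ℕ.* suc o                  ≡⟨ shift w o ⟩
    2 ℕ.+ (w ℕ.+ 2 ℕ.* o)              ≡⟨ cong (2 ℕ.+_) (weight-⊕ A B) ⟩
    2 ℕ.+ (weight A ℕ.+ weight B)      ≡⟨ cong suc (ℕ.+-suc (weight A) (weight B)) ⟨
    suc (weight A) ℕ.+ suc (weight B)  ∎
    where
    w = weight (A ⊕ B)
    o = weight (zipWith _∧_ A B)
    shift : ∀ x o → x ℕ.+ 2 ℕ.* suc o ≡ 2 ℕ.+ (x ℕ.+ 2 ℕ.* o)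
    shift = ℕ-solve-∀

  complement : Vec Bool n → Vec Bool n
  complement = Vec.map not

  complement-involutive : ∀ (x : Vec Bool n) → complement (complement x) ≡ x
  complement-involutive []      = refl
  complement-involutive (b ∷ x) = cong₂ _∷_ (not-involutive b) (complement-involutive x)

  complement-injective : ∀ {x y : Vec Bool n} → complement x ≡ complement y → x ≡ y
  complement-injective {x = x} {y} eq =
    trans (sym (complement-involutive x)) (trans (cong complement eq) (complement-involutive y))

  ≢-complement : ∀ (x : Vec Bool (suc n)) → x ≢ complement x
  ≢-complement (b ∷ x) eq = not-¬ refl (cong Vec.head eq)

  -1^j*-1^j≡1 : ∀ j → -1ℤ ^ j * -1ℤ ^ j ≡ 1ℤ
  -1^j*-1^j≡1 zero    = refl
  -1^j*-1^j≡1 (suc j) = trans (square-neg (-1ℤ ^ j)) (-1^j*-1^j≡1 j)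
    where
    square-neg : ∀ p → (-1ℤ * p) * (-1ℤ * p) ≡ p * p
    square-neg = solve-∀

  -1^[w+2j]≡-1^w : ∀ w j → -1ℤ ^ (w ℕ.+ 2 ℕ.* j) ≡ -1ℤ ^ w
  -1^[w+2j]≡-1^w w j = begin
    -1ℤ ^ (w ℕ.+ (j ℕ.+ (j ℕ.+ 0)))     ≡⟨ ^-distribˡ-+-* -1ℤ w (j ℕ.+ (j ℕ.+ 0)) ⟩
    -1ℤ ^ w * -1ℤ ^ (j ℕ.+ (j ℕ.+ 0))
      ≡⟨ cong (λ p → -1ℤ ^ w * p) (^-distribˡ-+-* -1ℤ j (j ℕ.+ 0)) ⟩
    -1ℤ ^ w * (-1ℤ ^ j * -1ℤ ^ (j ℕ.+ 0))
      ≡⟨ cong (λ m → -1ℤ ^ w * (-1ℤ ^ j * -1ℤ ^ m)) (ℕ.+-identityʳ j) ⟩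
    -1ℤ ^ w * (-1ℤ ^ j * -1ℤ ^ j)       ≡⟨ cong (λ p → -1ℤ ^ w * p) (-1^j*-1^j≡1 j) ⟩
    -1ℤ ^ w * 1ℤ                        ≡⟨ *-identityʳ _ ⟩
    -1ℤ ^ w                             ∎

  χ-complement : ∀ (S x : Vec Bool n) → χ S (complement x) ≡ -1ℤ ^ weight S * χ S x
  χ-complement []          []      = refl
  χ-complement (false ∷ S) (_ ∷ x) = χ-complement S x
  χ-complement (true  ∷ S) (b ∷ x) = begin
    sign (not b) * χ S (complement x)           ≡⟨ cong₂ _*_ (sign-not b) (χ-complement S x) ⟩
    (-1ℤ * sign b) * (-1ℤ ^ weight S * χ S x)   ≡⟨ regroup (sign b) (-1ℤ ^ weight S) (χ S x) ⟩
    (-1ℤ * -1ℤ ^ weight S) * (sign b * χ S x)   ∎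
    where
    sign-not : ∀ b → sign (not b) ≡ -1ℤ * sign b
    sign-not false = refl
    sign-not true  = refl
    regroup : ∀ s p c → (-1ℤ * s) * (p * c) ≡ (-1ℤ * p) * (s * c)
    regroup = solve-∀

  vectorsOfWeight : (n i : ℕ) → List (Vec Bool n)
  vectorsOfWeight zero    zero    = [] ∷ []
  vectorsOfWeight zero    (suc i) = []
  vectorsOfWeight (suc n) zero    = map (false ∷_) (vectorsOfWeight n zero)
  vectorsOfWeight (suc n) (suc i) =
    map (false ∷_) (vectorsOfWeight n (suc i)) ++ map (true ∷_) (vectorsOfWeight n i)

  ∈-vectorsOfWeight : ∀ (S : Vec Bool n) → S ∈ vectorsOfWeight n (weight S)
  ∈-vectorsOfWeight [] = here refl
  ∈-vectorsOfWeight (false ∷ S) with weight S | ∈-vectorsOfWeight S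
  ... | zero  | S∈ = ∈-map⁺ (false ∷_) S∈
  ... | suc _ | S∈ = ∈-++⁺ˡ (∈-map⁺ (false ∷_) S∈)
  ∈-vectorsOfWeight {suc n} (true ∷ S) =
    ∈-++⁺ʳ (map (false ∷_) (vectorsOfWeight n (suc (weight S))))
           (∈-map⁺ (true ∷_) (∈-vectorsOfWeight S))

  vectorsOfWeight-weight : ∀ {n} i {S : Vec Bool n} → S ∈ vectorsOfWeight n i → weight S ≡ i
  vectorsOfWeight-weight {zero} zero (here refl) = refl
  vectorsOfWeight-weight {suc n} zero S∈ with ∈-map⁻ (false ∷_) S∈
  ... | _ , S′∈ , refl = vectorsOfWeight-weight zero S′∈
  vectorsOfWeight-weight {suc n} (suc i) S∈ with ∈-++⁻ (map (false ∷_) (vectorsOfWeight n (suc i))) S∈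
  ... | inj₁ S∈₀ with ∈-map⁻ (false ∷_) S∈₀
  ...   | _ , S′∈ , refl = vectorsOfWeight-weight (suc i) S′∈
  vectorsOfWeight-weight {suc n} (suc i) S∈ | inj₂ S∈₁ with ∈-map⁻ (true ∷_) S∈₁
  ...   | _ , S′∈ , refl = cong suc (vectorsOfWeight-weight i S′∈)

  krawtchouk : (n i : ℕ) → Vec Bool n → ℤ
  krawtchouk n i z = ∑ (vectorsOfWeight n i) (λ S → χ S z)

  krawtchouk-zero : ∀ n (z : Vec Bool n) → krawtchouk n 0 z ≡ 1ℤ
  krawtchouk-zero zero    []      = refl
  krawtchouk-zero (suc n) (b ∷ z) =
    trans (∑-map (false ∷_) (vectorsOfWeight n 0) (λ S → χ S (b ∷ z))) (krawtchouk-zero n z)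

  krawtchouk-∷ : ∀ n i b (z : Vec Bool n) →
                 krawtchouk (suc n) (suc i) (b ∷ z) ≡ krawtchouk n (suc i) z + sign b * krawtchouk n i z
  krawtchouk-∷ n i b z = begin
    ∑ (map (false ∷_) V₁ ++ map (true ∷_) V₀) (λ S → χ S (b ∷ z))
      ≡⟨ ∑-++ (map (false ∷_) V₁) _ _ ⟩
    ∑ (map (false ∷_) V₁) (λ S → χ S (b ∷ z)) + ∑ (map (true ∷_) V₀) (λ S → χ S (b ∷ z))
      ≡⟨ cong₂ _+_ (∑-map (false ∷_) V₁ _)
                   (trans (∑-map (true ∷_) V₀ _) (∑-*ˡ V₀ (sign b) (λ S → χ S z))) ⟩
    krawtchouk n (suc i) z + sign b * krawtchouk n i z ∎
    where
    V₁ = vectorsOfWeight n (suc i)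
    V₀ = vectorsOfWeight n i

  n-2weight-∷ : ∀ {n} b (z : Vec Bool n) →
              + suc n - + (2 ℕ.* weight (b ∷ z)) ≡ (+ n - + (2 ℕ.* weight z)) + sign b
  n-2weight-∷ {n} false z = shift (+ n) (+ (2 ℕ.* weight z))
    where
    shift : ∀ N W → (1ℤ + N) - W ≡ (N - W) + 1ℤ
    shift = solve-∀
  n-2weight-∷ {n} true z =
    trans (cong (λ w → + suc n - + w) (ℕ.*-suc 2 (weight z))) (shift (+ n) (+ (2 ℕ.* weight z)))
    where
    shift : ∀ N W → (1ℤ + N) - (+ 2 + W) ≡ (N - W) + -1ℤ
    shift = solve-∀

  krawtchouk-one : ∀ n (z : Vec Bool n) → krawtchouk n 1 z ≡ + n - + (2 ℕ.* weight z)
  krawtchouk-one zero    []      = refl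
  krawtchouk-one (suc n) (b ∷ z) = begin
    krawtchouk (suc n) 1 (b ∷ z)                  ≡⟨ krawtchouk-∷ n 0 b z ⟩
    krawtchouk n 1 z + sign b * krawtchouk n 0 z  ≡⟨ cong₂ (λ k k₀ → k + sign b * k₀)
                                                           (krawtchouk-one n z) (krawtchouk-zero n z) ⟩
    D + sign b * 1ℤ                               ≡⟨ cong (λ s → D + s) (*-identityʳ (sign b)) ⟩
    D + sign b                                    ≡⟨ n-2weight-∷ b z ⟨
    + suc n - + (2 ℕ.* weight (b ∷ z))            ∎
    where
    D = + n - + (2 ℕ.* weight z)

  krawtchouk-rec : ∀ n (z : Vec Bool n) i →
    + (2 ℕ.+ i) * krawtchouk n (2 ℕ.+ i) z + (+ n - + i) * krawtchouk n i z
      ≡ (+ n - + (2 ℕ.* weight z)) * krawtchouk n (1 ℕ.+ i) z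
  krawtchouk-rec zero    []      zero    = refl
  krawtchouk-rec zero    []      (suc i) = cong₂ _+_ (*-zeroʳ (+ (3 ℕ.+ i))) (*-zeroʳ (+ 0 - + suc i))
  krawtchouk-rec (suc n) (b ∷ z) zero    = begin
    + 2 * K′ 2 + (+ suc n - 0ℤ) * K′ 0
      ≡⟨ cong₂ (λ k₂ k₀ → + 2 * k₂ + (+ suc n - 0ℤ) * k₀)
               (krawtchouk-∷ n 1 b z) (krawtchouk-zero (suc n) (b ∷ z)) ⟩
    + 2 * (K 2 + s * K 1) + (+ suc n - 0ℤ) * 1ℤ
      ≡⟨ rec-∷ (+ n) (K 1) (K 2) (krawtchouk-one n z) rec₀ ⟩
    (D + s) * (K 1 + s * 1ℤ)
      ≡⟨ cong₂ _*_ (n-2weight-∷ b z)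
                   (trans (krawtchouk-∷ n 0 b z) (cong (λ k₀ → K 1 + s * k₀) (krawtchouk-zero n z))) ⟨
    (+ suc n - + (2 ℕ.* weight (b ∷ z))) * K′ 1 ∎
    where
    K  = λ i → krawtchouk n i z
    K′ = λ i → krawtchouk (suc n) i (b ∷ z)
    s  = sign b
    D  = + n - + (2 ℕ.* weight z)
    rec₀ : + 2 * K 2 + (+ n - 0ℤ) * 1ℤ ≡ D * K 1
    rec₀ = subst (λ k₀ → + 2 * K 2 + (+ n - 0ℤ) * k₀ ≡ D * K 1) (krawtchouk-zero n z) (krawtchouk-rec n z 0)
    rec-∷ : ∀ N e₁ e₂ → e₁ ≡ D → + 2 * e₂ + (N - 0ℤ) * 1ℤ ≡ D * e₁ →
            + 2 * (e₂ + s * e₁) + ((1ℤ + N) - 0ℤ) * 1ℤ ≡ (D + s) * (e₁ + s * 1ℤ)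
    rec-∷ N e₁ e₂ e₁≡D e-rec = begin
      + 2 * (e₂ + s * e₁) + ((1ℤ + N) - 0ℤ) * 1ℤ         ≡⟨ regroup N e₁ e₂ s ⟩
      (+ 2 * e₂ + (N - 0ℤ) * 1ℤ) + s * e₁ + s * e₁ + 1ℤ
        ≡⟨ cong₂ (λ x y → x + s * e₁ + s * y + 1ℤ) e-rec e₁≡D ⟩
      D * e₁ + s * e₁ + s * D + 1ℤ
        ≡⟨ cong (λ u → D * e₁ + s * e₁ + s * D + u) (sign*sign b) ⟨
      D * e₁ + s * e₁ + s * D + s * s                    ≡⟨ factor D e₁ s ⟩
      (D + s) * (e₁ + s * 1ℤ)                            ∎
      where
      regroup : ∀ N e₁ e₂ s → + 2 * (e₂ + s * e₁) + ((1ℤ + N) - 0ℤ) * 1ℤ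
                              ≡ (+ 2 * e₂ + (N - 0ℤ) * 1ℤ) + s * e₁ + s * e₁ + 1ℤ
      regroup = solve-∀
      factor : ∀ D e₁ s → D * e₁ + s * e₁ + s * D + s * s ≡ (D + s) * (e₁ + s * 1ℤ)
      factor = solve-∀
  krawtchouk-rec (suc n) (b ∷ z) (suc i) = begin
    + (3 ℕ.+ i) * K′ (3 ℕ.+ i) + (+ suc n - + suc i) * K′ (suc i)
      ≡⟨ cong₂ (λ k₃ k₁ → + (3 ℕ.+ i) * k₃ + (+ suc n - + suc i) * k₁)
               (krawtchouk-∷ n (2 ℕ.+ i) b z) (krawtchouk-∷ n i b z) ⟩
    + (3 ℕ.+ i) * (K (3 ℕ.+ i) + s * K (2 ℕ.+ i)) + (+ suc n - + suc i) * (K (1 ℕ.+ i) + s * K i)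
      ≡⟨ rec-∷ (+ n) (+ i) (K i) (K (1 ℕ.+ i)) (K (2 ℕ.+ i)) (K (3 ℕ.+ i))
               (krawtchouk-rec n z i) (krawtchouk-rec n z (suc i)) ⟩
    (D + s) * (K (2 ℕ.+ i) + s * K (1 ℕ.+ i))
      ≡⟨ cong₂ _*_ (n-2weight-∷ b z) (krawtchouk-∷ n (suc i) b z) ⟨
    (+ suc n - + (2 ℕ.* weight (b ∷ z))) * K′ (2 ℕ.+ i) ∎
    where
    K  = λ i → krawtchouk n i z
    K′ = λ i → krawtchouk (suc n) i (b ∷ z)
    s  = sign b
    D  = + n - + (2 ℕ.* weight z)
    rec-∷ : ∀ N J e₀ e₁ e₂ e₃ →
            (+ 2 + J) * e₂ + (N - J) * e₀ ≡ D * e₁ →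
            (+ 3 + J) * e₃ + (N - (1ℤ + J)) * e₁ ≡ D * e₂ →
            (+ 3 + J) * (e₃ + s * e₂) + ((1ℤ + N) - (1ℤ + J)) * (e₁ + s * e₀) ≡ (D + s) * (e₂ + s * e₁)
    rec-∷ N J e₀ e₁ e₂ e₃ e-rec₀ e-rec₁ = begin
      (+ 3 + J) * (e₃ + s * e₂) + ((1ℤ + N) - (1ℤ + J)) * (e₁ + s * e₀)
        ≡⟨ regroup N J e₀ e₁ e₂ e₃ s ⟩
      ((+ 3 + J) * e₃ + (N - (1ℤ + J)) * e₁) + s * ((+ 2 + J) * e₂ + (N - J) * e₀) + s * e₂ + 1ℤ * e₁
        ≡⟨ cong₂ (λ x y → x + s * y + s * e₂ + 1ℤ * e₁) e-rec₁ e-rec₀ ⟩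
      D * e₂ + s * (D * e₁) + s * e₂ + 1ℤ * e₁
        ≡⟨ cong (λ u → D * e₂ + s * (D * e₁) + s * e₂ + u * e₁) (sign*sign b) ⟨
      D * e₂ + s * (D * e₁) + s * e₂ + (s * s) * e₁
        ≡⟨ factor D e₁ e₂ s ⟩
      (D + s) * (e₂ + s * e₁) ∎
      where
      regroup : ∀ N J e₀ e₁ e₂ e₃ s →
        (+ 3 + J) * (e₃ + s * e₂) + ((1ℤ + N) - (1ℤ + J)) * (e₁ + s * e₀)
          ≡ ((+ 3 + J) * e₃ + (N - (1ℤ + J)) * e₁) + s * ((+ 2 + J) * e₂ + (N - J) * e₀)
            + s * e₂ + 1ℤ * e₁
      regroup = solve-∀
      factor : ∀ D e₁ e₂ s → D * e₂ + s * (D * e₁) + s * e₂ + (s * s) * e₁ ≡ (D + s) * (e₂ + s * e₁)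
      factor = solve-∀


open Binomials
open Characters

module KrawtchoukPolynomials where

  open import Data.Nat as ℕ using (ℕ; zero; suc; NonZero; _≤_)
  import Data.Nat.Properties as ℕ
  open import Data.Nat.Combinatorics using (_C_; nC1≡n)
  open import Data.Integer as ℤ using (ℤ; +_; 1ℤ)
  import Data.Integer.Properties as ℤ
  open import Data.Integer.Tactic.RingSolver using (solve-∀)
  open import Data.Rational using (ℚ; 1ℚ; _+_; _*_; _-_)
  open import Data.Rational.Properties
  open import Data.Rational.Solver using (module +-*-Solver)
  open import Algebra.Bundles using (CommutativeRing)
  open import Algebra.Properties.CommutativeSemigroup
    (CommutativeRing.*-commutativeSemigroup +-*-commutativeRing) using (x∙yz≈y∙xz)
  open ≡-Reasoning

  -- Multiplying by n C i turns the recurrence defining Q into the one assumed for e.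
  module _ (n d : ℕ) .{{_ : NonZero n}} (e : ℕ → ℤ) (e-zero : e 0 ≡ 1ℤ)
           (e-one : e 1 ≡ + n ℤ.- + (2 ℕ.* d))
           (e-rec : ∀ i → + (2 ℕ.+ i) ℤ.* e (2 ℕ.+ i) ℤ.+ (+ n ℤ.- + i) ℤ.* e i
                            ≡ (+ n ℤ.- + (2 ℕ.* d)) ℤ.* e (1 ℕ.+ i)) where

    private
      t : ℚ
      t = 1ℚ - (ℕ→ℚ (2 ℕ.* d) ÷ℕ n)

      c : ℕ → ℚ
      c i = ℕ→ℚ (n C i)

      T : ℚ
      T = ℕ→ℚ n * t

      T≡ι : T ≡ ι (+ n ℤ.- + (2 ℕ.* d))
      T≡ι = begin
        ℕ→ℚ n * (1ℚ - x ÷ℕ n)    ≡⟨ expand (ℕ→ℚ n) (x ÷ℕ n) ⟩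
        ℕ→ℚ n - (x ÷ℕ n) * ℕ→ℚ n ≡⟨ cong (ℕ→ℚ n -_) (÷ℕ-*-inverse x n) ⟩
        ℕ→ℚ n - x                ≡⟨ ι-minus (+ n) (+ (2 ℕ.* d)) ⟨
        ι (+ n ℤ.- + (2 ℕ.* d))  ∎
        where
        x = ℕ→ℚ (2 ℕ.* d)
        open +-*-Solver
        expand : ∀ m y → m * (1ℚ - y) ≡ m - y * m
        expand = solve 2 (λ m y → m :* (con 1ℚ :- y) := m :- y :* m) refl

      absorption : ∀ i → ℕ→ℚ (suc i) * c (suc i) ≡ ℕ→ℚ (n ℕ.∸ i) * c i
      absorption i = begin
        ℕ→ℚ (suc i) * ℕ→ℚ (n C suc i)    ≡⟨ ℕ→ℚ-* (suc i) (n C suc i) ⟨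
        ℕ→ℚ (suc i ℕ.* (n C suc i))      ≡⟨ cong ℕ→ℚ (C-absorption n i) ⟩
        ℕ→ℚ ((n ℕ.∸ i) ℕ.* (n C i))      ≡⟨ ℕ→ℚ-* (n ℕ.∸ i) (n C i) ⟩
        ℕ→ℚ (n ℕ.∸ i) * ℕ→ℚ (n C i)      ∎

      Q-rec : ∀ i → 2 ℕ.+ i ≤ n →
              Q n (2 ℕ.+ i) t * ℕ→ℚ (n ℕ.∸ suc i) ≡ T * Q n (1 ℕ.+ i) t - ℕ→ℚ (1 ℕ.+ i) * Q n i t
      Q-rec i 2+i≤n = ÷ℕ-*-inverse (T * Q n (1 ℕ.+ i) t - ℕ→ℚ (1 ℕ.+ i) * Q n i t) (n ℕ.∸ suc i)
                        {{ℕ.>-nonZero (ℕ.m<n⇒0<n∸m 2+i≤n)}}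

      e-rec-ℚ : ∀ i → i ≤ n →
                ℕ→ℚ (2 ℕ.+ i) * ι (e (2 ℕ.+ i)) ≡ T * ι (e (1 ℕ.+ i)) - ℕ→ℚ (n ℕ.∸ i) * ι (e i)
      e-rec-ℚ i i≤n = begin
        ι (+ (2 ℕ.+ i)) * ι (e (2 ℕ.+ i))  ≡⟨ ι-* (+ (2 ℕ.+ i)) (e (2 ℕ.+ i)) ⟨
        ι a                                ≡⟨ cong ι (add-sub a b) ⟩
        ι (a ℤ.+ b ℤ.- b)                  ≡⟨ cong (λ x → ι (x ℤ.- b)) (e-rec i) ⟩
        ι (T′ ℤ.* e (1 ℕ.+ i) ℤ.- b)       ≡⟨ ι-minus (T′ ℤ.* e (1 ℕ.+ i)) b ⟩
        ι (T′ ℤ.* e (1 ℕ.+ i)) - ι b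
          ≡⟨ cong₂ _-_ (ι-* T′ (e (1 ℕ.+ i))) (ι-* (+ n ℤ.- + i) (e i)) ⟩
        ι T′ * ι (e (1 ℕ.+ i)) - ι (+ n ℤ.- + i) * ι (e i)
          ≡⟨ cong₂ (λ u v → u * ι (e (1 ℕ.+ i)) - ι v * ι (e i)) (sym T≡ι) n-i≡n∸i ⟩
        T * ι (e (1 ℕ.+ i)) - ℕ→ℚ (n ℕ.∸ i) * ι (e i) ∎
        where
        T′ = + n ℤ.- + (2 ℕ.* d)
        a  = + (2 ℕ.+ i) ℤ.* e (2 ℕ.+ i)
        b  = (+ n ℤ.- + i) ℤ.* e i
        add-sub : ∀ a b → a ≡ a ℤ.+ b ℤ.- b
        add-sub = solve-∀
        n-i≡n∸i : + n ℤ.- + i ≡ + (n ℕ.∸ i)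
        n-i≡n∸i = trans (ℤ.m-n≡m⊖n n i) (ℤ.⊖-≥ i≤n)

    Q*nCi≡ι : ∀ i → i ≤ n → Q n i t * c i ≡ ι (e i)
    Q*nCi≡ι zero          _     = cong ι (sym e-zero)
    Q*nCi≡ι (suc zero)    _     = begin
      t * ℕ→ℚ (n C 1) ≡⟨ cong (λ m → t * ℕ→ℚ m) (nC1≡n n) ⟩
      t * ℕ→ℚ n       ≡⟨ *-comm t (ℕ→ℚ n) ⟩
      T               ≡⟨ trans T≡ι (cong ι (sym e-one)) ⟩
      ι (e 1)         ∎
    Q*nCi≡ι (suc (suc i)) 2+i≤n = ℕ→ℚ-*-cancelˡ (2 ℕ.+ i) (begin
      ℕ→ℚ (2 ℕ.+ i) * (q₂ * c₂)                  ≡⟨ x∙yz≈y∙xz (ℕ→ℚ (2 ℕ.+ i)) q₂ c₂ ⟩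
      q₂ * (ℕ→ℚ (2 ℕ.+ i) * c₂)                  ≡⟨ cong (q₂ *_) (absorption (suc i)) ⟩
      q₂ * (ℕ→ℚ (n ℕ.∸ suc i) * c₁)              ≡⟨ *-assoc q₂ (ℕ→ℚ (n ℕ.∸ suc i)) c₁ ⟨
      (q₂ * ℕ→ℚ (n ℕ.∸ suc i)) * c₁              ≡⟨ cong (_* c₁) (Q-rec i 2+i≤n) ⟩
      (T * q₁ - ℕ→ℚ (1 ℕ.+ i) * q₀) * c₁         ≡⟨ distribute T q₁ (ℕ→ℚ (1 ℕ.+ i)) q₀ c₁ ⟩
      T * (q₁ * c₁) - q₀ * (ℕ→ℚ (1 ℕ.+ i) * c₁)
        ≡⟨ cong₂ (λ u v → T * u - q₀ * v) (Q*nCi≡ι (suc i) i+1≤n) (absorption i) ⟩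
      T * e₁ - q₀ * (M * c i)                    ≡⟨ cong (λ v → T * e₁ - v) (x∙yz≈y∙xz q₀ M (c i)) ⟩
      T * e₁ - M * (q₀ * c i)                    ≡⟨ cong (λ v → T * e₁ - M * v) (Q*nCi≡ι i i≤n) ⟩
      T * e₁ - M * e₀                            ≡⟨ e-rec-ℚ i i≤n ⟨
      ℕ→ℚ (2 ℕ.+ i) * ι (e (2 ℕ.+ i))            ∎)
      where
      i+1≤n = ℕ.<⇒≤ 2+i≤n
      i≤n   = ℕ.≤-trans (ℕ.n≤1+n i) i+1≤n
      q₀ = Q n i t
      q₁ = Q n (suc i) t
      q₂ = Q n (suc (suc i)) t
      c₁ = c (1 ℕ.+ i)
      c₂ = c (2 ℕ.+ i)
      e₀ = ι (e i)
      e₁ = ι (e (1 ℕ.+ i))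
      M  = ℕ→ℚ (n ℕ.∸ i)
      distribute : ∀ T q₁ a q₀ c → (T * q₁ - a * q₀) * c ≡ T * (q₁ * c) - q₀ * (a * c)
      distribute = solve 5 (λ T q₁ a q₀ c → (T :* q₁ :- a :* q₀) :* c
                                         := T :* (q₁ :* c) :- q₀ :* (a :* c)) refl
        where open +-*-Solver


open KrawtchoukPolynomials

module Moments where

  open import Data.Nat as ℕ using (ℕ; NonZero; _≤_; z≤n; s≤s)
  import Data.Nat.Properties as ℕ
  open import Data.Nat.Combinatorics using () renaming (_C_ to _choose_)
  open import Data.Integer as ℤ using (ℤ; +_; 0ℤ; 1ℤ)
  import Data.Integer.Properties as ℤ
  open import Data.Rational using (ℚ; 0ℚ; _+_; _*_)
  open import Data.Rational.Properties
  open ≡-Reasoning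

  private variable
    A : Set
    n : ℕ

  fourier : List (Vec Bool n) → Vec Bool n → ℤ
  fourier C S = ∑ C (χ S)

  weight≤n : ∀ (S : Vec Bool n) → weight S ≤ n
  weight≤n []          = z≤n
  weight≤n (false ∷ S) = ℕ.m≤n⇒m≤1+n (weight≤n S)
  weight≤n (true  ∷ S) = s≤s (weight≤n S)

  Q-inner*nCi≡krawtchouk : ∀ .{{_ : NonZero n}} (x y : Vec Bool n) i → i ≤ n →
                           Q n i (inner x y) * ℕ→ℚ (n choose i) ≡ ι (krawtchouk n i (x ⊕ y))
  Q-inner*nCi≡krawtchouk {n} x y =
    Q*nCi≡ι n (hamming x y) (λ i → krawtchouk n i (x ⊕ y)) (krawtchouk-zero n (x ⊕ y))
            (trans (krawtchouk-one n (x ⊕ y)) (cong (λ d → + n ℤ.- + (2 ℕ.* d)) w≡d))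
            (λ i → trans (krawtchouk-rec n (x ⊕ y) i)
                         (cong (λ d → (+ n ℤ.- + (2 ℕ.* d)) ℤ.* krawtchouk n (1 ℕ.+ i) (x ⊕ y)) w≡d))
    where
    w≡d : weight (x ⊕ y) ≡ hamming x y
    w≡d = sym (hamming≡weight-⊕ x y)

  sumℚ-concatMap-* : ∀ (as : List A) (g : A → A → ℚ) (G : A → A → ℤ) c →
                     (∀ a b → g a b * c ≡ ι (G a b)) →
                     sumℚ (concatMap (λ a → map (g a) as) as) * c ≡ ι (∑ as (λ a → ∑ as (G a)))
  sumℚ-concatMap-* {A} as g G c g*c≡G = rows as
    where
    sumℚ-++ : ∀ ps qs → sumℚ (ps ++ qs) ≡ sumℚ ps + sumℚ qs
    sumℚ-++ []       qs = sym (+-identityˡ _)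
    sumℚ-++ (p ∷ ps) qs = trans (cong (λ q → p + q) (sumℚ-++ ps qs)) (sym (+-assoc p _ _))
    row-sum : ∀ a bs → sumℚ (map (g a) bs) * c ≡ ι (∑ bs (G a))
    row-sum a []       = *-zeroˡ c
    row-sum a (b ∷ bs) = trans (*-distribʳ-+ c (g a b) _)
      (trans (cong₂ _+_ (g*c≡G a b) (row-sum a bs)) (sym (ι-+ (G a b) _)))
    rows : ∀ bs → sumℚ (concatMap (λ a → map (g a) as) bs) * c ≡ ι (∑ bs (λ a → ∑ as (G a)))
    rows []       = *-zeroˡ c
    rows (b ∷ bs) = begin
      sumℚ (map (g b) as ++ concatMap (λ a → map (g a) as) bs) * c
        ≡⟨ cong (_* c) (sumℚ-++ (map (g b) as) _) ⟩
      (sumℚ (map (g b) as) + sumℚ (concatMap (λ a → map (g a) as) bs)) * c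
        ≡⟨ *-distribʳ-+ c (sumℚ (map (g b) as)) _ ⟩
      sumℚ (map (g b) as) * c + sumℚ (concatMap (λ a → map (g a) as) bs) * c
        ≡⟨ cong₂ _+_ (row-sum b as) (rows bs) ⟩
      ι (∑ as (G b)) + ι (∑ bs (λ a → ∑ as (G a)))
        ≡⟨ ι-+ (∑ as (G b)) _ ⟨
      ι (∑ (b ∷ bs) (λ a → ∑ as (G a))) ∎

  ∑∑χχ≡∑fourier² : ∀ (I : List A) (s : A → Vec Bool n) (C : List (Vec Bool n)) →
                   ∑ C (λ x → ∑ C (λ y → ∑ I (λ i → χ (s i) x ℤ.* χ (s i) y)))
                     ≡ ∑ I (λ i → fourier C (s i) ℤ.* fourier C (s i))
  ∑∑χχ≡∑fourier² I s C = begin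
    ∑ C (λ x → ∑ C (λ y → ∑ I (λ i → χ (s i) x ℤ.* χ (s i) y)))
      ≡⟨ ∑-cong {as = C} (λ {x} _ → ∑-swap C I (λ y i → χ (s i) x ℤ.* χ (s i) y)) ⟩
    ∑ C (λ x → ∑ I (λ i → ∑ C (λ y → χ (s i) x ℤ.* χ (s i) y)))
      ≡⟨ ∑-swap C I (λ x i → ∑ C (λ y → χ (s i) x ℤ.* χ (s i) y)) ⟩
    ∑ I (λ i → ∑ C (λ x → ∑ C (λ y → χ (s i) x ℤ.* χ (s i) y)))
      ≡⟨ ∑-cong {as = I} (λ {i} _ → ∑-*-∑ C C (χ (s i)) (χ (s i))) ⟨
    ∑ I (λ i → fourier C (s i) ℤ.* fourier C (s i)) ∎

  energy : ∀ {n} → ℕ → List (Vec Bool n) → ℤ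
  energy {n} i C = ∑ (vectorsOfWeight n i) (λ S → fourier C S ℤ.* fourier C S)

  moment*nCi≡energy : ∀ .{{_ : NonZero n}} i (C : List (Vec Bool n)) → i ≤ n →
                      moment i C * ℕ→ℚ (n choose i) ≡ ι (energy i C)
  moment*nCi≡energy {n} i C i≤n = begin
    moment i C * ℕ→ℚ (n choose i)
      ≡⟨ sumℚ-concatMap-* C (λ x y → Q n i (inner x y)) (λ x y → krawtchouk n i (x ⊕ y))
                          (ℕ→ℚ (n choose i)) (λ x y → Q-inner*nCi≡krawtchouk x y i i≤n) ⟩
    ι (∑ C (λ x → ∑ C (λ y → ∑ V (λ S → χ S (x ⊕ y)))))
      ≡⟨ cong ι (∑-cong {as = C} (λ {x} _ → ∑-cong {as = C} (λ {y} _ →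
                  ∑-cong {as = V} (λ {S} _ → χ-⊕ʳ S x y)))) ⟩
    ι (∑ C (λ x → ∑ C (λ y → ∑ V (λ S → χ S x ℤ.* χ S y))))
      ≡⟨ cong ι (∑∑χχ≡∑fourier² V (λ S → S) C) ⟩
    ι (energy i C) ∎
    where
    V = vectorsOfWeight n i

  moment≡0⇒fourier≡0 : ∀ .{{_ : NonZero n}} (C : List (Vec Bool n)) S →
                       moment (weight S) C ≡ 0ℚ → fourier C S ≡ 0ℤ
  moment≡0⇒fourier≡0 {n} C S M≡0 = ∑-squares≡0 (fourier C) energy≡0 (∈-vectorsOfWeight S)
    where
    energy≡0 : energy (weight S) C ≡ 0ℤ
    energy≡0 = ι-injective (begin
      ι (energy (weight S) C)                        ≡⟨ moment*nCi≡energy (weight S) C (weight≤n S) ⟨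
      moment (weight S) C * ℕ→ℚ (n choose weight S)  ≡⟨ cong (_* ℕ→ℚ (n choose weight S)) M≡0 ⟩
      0ℚ * ℕ→ℚ (n choose weight S)                   ≡⟨ *-zeroˡ (ℕ→ℚ (n choose weight S)) ⟩
      0ℚ                                             ∎)

  fourier≡0⇒moment≡0 : ∀ .{{_ : NonZero n}} i (C : List (Vec Bool n)) → i ≤ n →
                       (∀ S → weight S ≡ i → fourier C S ≡ 0ℤ) → moment i C ≡ 0ℚ
  fourier≡0⇒moment≡0 {n} i C i≤n vanish = ℕ→ℚ-*-cancelˡ (n choose i) {{ℕ.>-nonZero (nCk>0 i≤n)}} (begin
    ℕ→ℚ (n choose i) * moment i C  ≡⟨ *-comm (ℕ→ℚ (n choose i)) (moment i C) ⟩
    moment i C * ℕ→ℚ (n choose i)  ≡⟨ moment*nCi≡energy i C i≤n ⟩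
    ι (energy i C)                 ≡⟨ cong ι (∑-zero (λ {S} S∈ → cong (ℤ._* fourier C S) (vanish′ S∈))) ⟩
    0ℚ                             ≡⟨ *-zeroʳ (ℕ→ℚ (n choose i)) ⟨
    ℕ→ℚ (n choose i) * 0ℚ          ∎)
    where
    vanish′ : ∀ {S} → S ∈ vectorsOfWeight n i → fourier C S ≡ 0ℤ
    vanish′ {S} S∈ = vanish S (vectorsOfWeight-weight i S∈)

  fourier-zeros : ∀ (C : List (Vec Bool n)) → fourier C (zeros n) ≡ + length C
  fourier-zeros C = trans (∑-cong {as = C} (λ {x} _ → χ-zerosˡ x))
                          (trans (∑-const C 1ℤ) (ℤ.*-identityʳ _))

  module _ .{{_ : NonZero n}} {C : List (Vec Bool n)} where

    IsDesign⇒fourier≡0 : ∀ {m} → IsDesign m C →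
                         ∀ S → 1 ≤ weight S → weight S ≤ m → fourier C S ≡ 0ℤ
    IsDesign⇒fourier≡0 design S 1≤w w≤m =
      moment≡0⇒fourier≡0 C S (design (weight S) 1≤w w≤m (weight≤n S))

    fourier≡0⇒IsDesign : ∀ {m} → (∀ S → 1 ≤ weight S → weight S ≤ m → fourier C S ≡ 0ℤ) →
                         IsDesign m C
    fourier≡0⇒IsDesign vanish i 1≤i i≤m i≤n =
      fourier≡0⇒moment≡0 i C i≤n (λ { S refl → vanish S 1≤i i≤m })

    IsKKDesign⇒fourier≡0 : ∀ {k} → IsKKDesign k C →
                           ∀ S {j} → weight S ≡ 2 ℕ.* j → 1 ≤ j → j ≤ k → fourier C S ≡ 0ℤ
    IsKKDesign⇒fourier≡0 design S w≡2j 1≤j j≤k =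
      moment≡0⇒fourier≡0 C S (subst (λ w → moment w C ≡ 0ℚ) (sym w≡2j) (design _ 1≤j j≤k))

    fourier≡0⇒IsKKDesign : ∀ {k} → 2 ℕ.* k ≤ n →
                           (∀ S {j} → weight S ≡ 2 ℕ.* j → 1 ≤ j → j ≤ k → fourier C S ≡ 0ℤ) →
                           IsKKDesign k C
    fourier≡0⇒IsKKDesign 2k≤n vanish j 1≤j j≤k =
      fourier≡0⇒moment≡0 (2 ℕ.* j) C (ℕ.≤-trans (ℕ.*-monoʳ-≤ 2 j≤k) 2k≤n)
                         (λ S w≡2j → vanish S w≡2j 1≤j j≤k)


open Moments

module Shortening where

  open import Data.Nat as ℕ using (ℕ; suc; _≤_; z≤n; s≤s)
  import Data.Nat.Properties as ℕ
  open import Data.Integer as ℤ using (ℤ; +_; 0ℤ; 1ℤ; -1ℤ; _+_; _*_)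
  import Data.Integer.Properties as ℤ
  import Data.Bool as Bool
  open ≡-Reasoning

  private variable
    n : ℕ

  zeroHeaded : List (Vec Bool (suc n)) → List (Vec Bool (suc n))
  zeroHeaded = filter (λ x → head x Bool.≟ false)

  flipHead : Vec Bool (suc n) → Vec Bool (suc n)
  flipHead (b ∷ S) = not b ∷ S

  χ-flipHead : ∀ (S x : Vec Bool (suc n)) → χ (flipHead S) x ≡ sign (head x) * χ S x
  χ-flipHead (false ∷ S) (b     ∷ x) = refl
  χ-flipHead (true  ∷ S) (false ∷ x) = sym (trans (ℤ.*-identityˡ _) (ℤ.*-identityˡ _))
  χ-flipHead (true  ∷ S) (true  ∷ x) = sym (trans (sym (ℤ.*-assoc -1ℤ -1ℤ _)) (ℤ.*-identityˡ _))

  2*∑-zeroHeaded : ∀ (D : List (Vec Bool (suc n))) f →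
                   + 2 * ∑ (zeroHeaded D) f ≡ ∑ D (λ x → (1ℤ + sign (head x)) * f x)
  2*∑-zeroHeaded []                f = refl
  2*∑-zeroHeaded ((false ∷ x) ∷ D) f = trans (ℤ.*-distribˡ-+ (+ 2) (f (false ∷ x)) _)
                                             (cong (λ s → + 2 * f (false ∷ x) + s) (2*∑-zeroHeaded D f))
  2*∑-zeroHeaded ((true  ∷ x) ∷ D) f = trans (2*∑-zeroHeaded D f) (sym (ℤ.+-identityˡ _))

  2*fourier-zeroHeaded : ∀ (D : List (Vec Bool (suc n))) S →
                         + 2 * fourier (zeroHeaded D) S ≡ fourier D S + fourier D (flipHead S)
  2*fourier-zeroHeaded D S = begin
    + 2 * fourier (zeroHeaded D) S            ≡⟨ 2*∑-zeroHeaded D (χ S) ⟩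
    ∑ D (λ x → (1ℤ + sign (head x)) * χ S x)  ≡⟨ ∑-cong {as = D} (λ {x} _ → split x) ⟩
    ∑ D (λ x → χ S x + χ (flipHead S) x)      ≡⟨ ∑-+ D (χ S) (χ (flipHead S)) ⟩
    fourier D S + fourier D (flipHead S)      ∎
    where
    split : ∀ x → (1ℤ + sign (head x)) * χ S x ≡ χ S x + χ (flipHead S) x
    split x = trans (ℤ.*-distribʳ-+ (χ S x) 1ℤ (sign (head x)))
                    (cong₂ _+_ (ℤ.*-identityˡ (χ S x)) (sym (χ-flipHead S x)))

  fourier-zeroHeaded≡0 : ∀ (D : List (Vec Bool (suc n))) S →
                         fourier D S ≡ 0ℤ → fourier D (flipHead S) ≡ 0ℤ → fourier (zeroHeaded D) S ≡ 0ℤ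
  fourier-zeroHeaded≡0 D S F≡0 F′≡0 = ℤ.*-cancelˡ-≡ (+ 2) (fourier (zeroHeaded D) S) 0ℤ (begin
    + 2 * fourier (zeroHeaded D) S        ≡⟨ 2*fourier-zeroHeaded D S ⟩
    fourier D S + fourier D (flipHead S)  ≡⟨ cong₂ _+_ F≡0 F′≡0 ⟩
    0ℤ                                    ≡⟨ ℤ.*-zeroʳ (+ 2) ⟨
    + 2 * 0ℤ                              ∎)

  2*length-zeroHeaded : ∀ {n} (D : List (Vec Bool (suc n))) → fourier D (true ∷ zeros n) ≡ 0ℤ →
                        2 ℕ.* length (zeroHeaded D) ≡ length D
  2*length-zeroHeaded {n} D F≡0 = ℤ.+-injective (begin
    + (2 ℕ.* length (zeroHeaded D))                           ≡⟨ ℤ.pos-* 2 (length (zeroHeaded D)) ⟩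
    + 2 * + length (zeroHeaded D)                             ≡⟨ cong (+ 2 *_) (fourier-zeros (zeroHeaded D)) ⟨
    + 2 * fourier (zeroHeaded D) (zeros (suc n))              ≡⟨ 2*fourier-zeroHeaded D (zeros (suc n)) ⟩
    fourier D (zeros (suc n)) + fourier D (true ∷ zeros n)    ≡⟨ cong₂ _+_ (fourier-zeros D) F≡0 ⟩
    + length D + 0ℤ                                           ≡⟨ ℤ.+-identityʳ (+ length D) ⟩
    + length D                                                ∎)

  flipHead-weight : ∀ {m} (S : Vec Bool (suc n)) → 2 ≤ weight S → weight S ≤ m →
                    1 ≤ weight (flipHead S) × weight (flipHead S) ≤ suc m
  flipHead-weight (false ∷ S) _         w≤m = s≤s z≤n , s≤s w≤m
  flipHead-weight (true  ∷ S) (s≤s 1≤w) w≤m = 1≤w , ℕ.m≤n⇒m≤1+n (ℕ.≤-trans (ℕ.n≤1+n _) w≤m)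

  zeroHeaded-tight : ∀ {n} k → 2 ℕ.* k ≤ suc n → (D : List (Vec Bool (suc n))) →
                     TightOddDesign k D → TightKKDesign k (zeroHeaded D)
  zeroHeaded-tight {n} k 2k≤n D ((D-unique , _) , D-design , |D|) =
    (Unique.filter⁺ _ D-unique , nonempty) , fourier≡0⇒IsKKDesign {C = C} 2k≤n vanish-even , |C|
    where
    C = zeroHeaded D
    vanish : ∀ S → 1 ≤ weight S → weight S ≤ suc (2 ℕ.* k) → fourier D S ≡ 0ℤ
    vanish = IsDesign⇒fourier≡0 {C = D} D-design
    |C| : length C ≡ binomSum (suc n) k
    |C| = ℕ.*-cancelˡ-≡ (length C) (binomSum (suc n) k) 2 (trans (2*length-zeroHeaded D F≡0) |D|)
      where
      F≡0 = vanish (true ∷ zeros n) (s≤s z≤n) (s≤s (subst (_≤ 2 ℕ.* k) (sym (weight-zeros n)) z≤n))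
    nonempty : C ≢ []
    nonempty C≡[] = ℕ.<-irrefl (trans (cong length (sym C≡[])) |C|) (binomSum>0 (suc n) k)
    vanish-even : ∀ S {j} → weight S ≡ 2 ℕ.* j → 1 ≤ j → j ≤ k → fourier C S ≡ 0ℤ
    vanish-even S w≡2j 1≤j j≤k = fourier-zeroHeaded≡0 D S
      (vanish S (ℕ.≤-trans (s≤s z≤n) 2≤w) (ℕ.m≤n⇒m≤1+n w≤2k))
      (uncurry (vanish (flipHead S)) (flipHead-weight S 2≤w w≤2k))
      where
      2≤w  = subst (2 ≤_) (sym w≡2j) (ℕ.*-monoʳ-≤ 2 1≤j)
      w≤2k = subst (_≤ 2 ℕ.* k) (sym w≡2j) (ℕ.*-monoʳ-≤ 2 j≤k)

module ParityBall where

  open import Data.Nat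
  open import Data.Nat.Properties
  open import Data.Nat.Tactic.RingSolver using (solve-∀)
  open import Data.List.Relation.Unary.All using ([])
  open import Data.List.Properties using (length-map; length-++)
  open import Data.Vec.Properties using (∷-injectiveʳ)
  open ≡-Reasoning

  parityBall : (n k : ℕ) → List (Vec Bool n)
  parityBall zero    zero          = [] ∷ []
  parityBall zero    (suc zero)    = []
  parityBall zero    (suc (suc k)) = parityBall zero k
  parityBall (suc n) zero          = map (false ∷_) (parityBall n zero)
  parityBall (suc n) (suc k)       =
    map (false ∷_) (parityBall n (suc k)) ++ map (true ∷_) (parityBall n k)

  ∈-parityBall⇒ : ∀ {n} k {A : Vec Bool n} → A ∈ parityBall n k → ∃[ j ] weight A + 2 * j ≡ k
  ∈-parityBall⇒ {zero} zero (here refl) = 0 , refl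
  ∈-parityBall⇒ {zero} (suc (suc k)) {[]} A∈ with ∈-parityBall⇒ k A∈
  ... | j , 2j≡k = suc j , trans (*-suc 2 j) (cong (2 +_) 2j≡k)
  ∈-parityBall⇒ {suc n} zero A∈ with ∈-map⁻ (false ∷_) A∈
  ... | _ , A′∈ , refl = ∈-parityBall⇒ zero A′∈
  ∈-parityBall⇒ {suc n} (suc k) A∈ with ∈-++⁻ (map (false ∷_) (parityBall n (suc k))) A∈
  ... | inj₁ A∈₀ with ∈-map⁻ (false ∷_) A∈₀
  ...   | _ , A′∈ , refl = ∈-parityBall⇒ (suc k) A′∈
  ∈-parityBall⇒ {suc n} (suc k) A∈ | inj₂ A∈₁ with ∈-map⁻ (true ∷_) A∈₁
  ...   | _ , A′∈ , refl with ∈-parityBall⇒ k A′∈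
  ...     | j , w+2j≡k = j , cong suc w+2j≡k

  length-parityBall-∷ : ∀ n k →
    length (parityBall (suc n) (suc k)) ≡ length (parityBall n (suc k)) + length (parityBall n k)
  length-parityBall-∷ n k = trans (length-++ (map (false ∷_) (parityBall n (suc k))))
    (cong₂ _+_ (length-map (false ∷_) (parityBall n (suc k))) (length-map (true ∷_) (parityBall n k)))

  parityBall-unique : ∀ n k → Unique (parityBall n k)
  parityBall-unique zero    zero          = [] ∷ []
  parityBall-unique zero    (suc zero)    = []
  parityBall-unique zero    (suc (suc k)) = parityBall-unique zero k
  parityBall-unique (suc n) zero          = Unique.map⁺ ∷-injectiveʳ (parityBall-unique n zero)
  parityBall-unique (suc n) (suc k)       = Unique.++⁺ (Unique.map⁺ ∷-injectiveʳ (parityBall-unique n (suc k)))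
                                                       (Unique.map⁺ ∷-injectiveʳ (parityBall-unique n k))
                                                       disjoint
    where
    disjoint : ∀ {v} → ¬ (v ∈ map (false ∷_) (parityBall n (suc k)) × v ∈ map (true ∷_) (parityBall n k))
    disjoint (v∈₀ , v∈₁) with ∈-map⁻ (false ∷_) v∈₀ | ∈-map⁻ (true ∷_) v∈₁
    ... | _ , _ , refl | _ , _ , ()

  length-parityBall : ∀ m k → length (parityBall (suc m) k) ≡ binomSum (suc m) k
  length-parityBall zero    zero    = refl
  length-parityBall zero    (suc k) = begin
    length (parityBall 1 (suc k))                          ≡⟨ length-parityBall-∷ 0 k ⟩
    length (parityBall 0 (suc k)) + length (parityBall 0 k) ≡⟨ base k ⟩
    1                                                      ≡⟨ binomSum-1 (suc k) ⟨
    binomSum 1 (suc k)                                     ∎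
    where
    base : ∀ k → length (parityBall 0 (suc k)) + length (parityBall 0 k) ≡ 1
    base zero          = refl
    base (suc zero)    = refl
    base (suc (suc k)) = base k
  length-parityBall (suc m) zero    =
    trans (length-map (false ∷_) (parityBall (suc m) 0)) (length-parityBall m zero)
  length-parityBall (suc m) (suc k) = begin
    length (parityBall (2 + m) (suc k))
      ≡⟨ length-parityBall-∷ (suc m) k ⟩
    length (parityBall (suc m) (suc k)) + length (parityBall (suc m) k)
      ≡⟨ cong₂ _+_ (length-parityBall m (suc k)) (length-parityBall m k) ⟩
    binomSum (suc m) (suc k) + binomSum (suc m) k
      ≡⟨ binomSum-pascal m k ⟨
    binomSum (2 + m) (suc k) ∎

  ⊕-parityBall : ∀ {n k} {A B : Vec Bool n} → A ∈ parityBall n k → B ∈ parityBall n k →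
                 ∃[ j ] weight (A ⊕ B) ≡ 2 * j × j ≤ k
  ⊕-parityBall {n} {k} {A} {B} A∈ B∈ with ∈-parityBall⇒ k A∈ | ∈-parityBall⇒ k B∈
  ... | a , wA+2a≡k | b , wB+2b≡k = k ∸ t , w≡2[k∸t] , m∸n≤m k t
    where
    w = weight (A ⊕ B)
    o = weight (zipWith _∧_ A B)
    t = o + a + b
    w+2t≡2k : w + 2 * t ≡ 2 * k
    w+2t≡2k = begin
      w + 2 * t                                    ≡⟨ regroup w o a b ⟩
      (w + 2 * o) + 2 * a + 2 * b                  ≡⟨ cong (λ x → x + 2 * a + 2 * b) (weight-⊕ A B) ⟩
      (weight A + weight B) + 2 * a + 2 * b        ≡⟨ interchange (weight A) (weight B) a b ⟩
      (weight A + 2 * a) + (weight B + 2 * b)      ≡⟨ cong₂ _+_ wA+2a≡k wB+2b≡k ⟩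
      k + k                                        ≡⟨ cong (k +_) (+-identityʳ k) ⟨
      2 * k                                        ∎
      where
      regroup : ∀ w o a b → w + 2 * (o + a + b) ≡ (w + 2 * o) + 2 * a + 2 * b
      regroup = solve-∀
      interchange : ∀ x y a b → (x + y) + 2 * a + 2 * b ≡ (x + 2 * a) + (y + 2 * b)
      interchange = solve-∀
    w≡2[k∸t] : w ≡ 2 * (k ∸ t)
    w≡2[k∸t] = begin
      w                   ≡⟨ m+n∸n≡m w (2 * t) ⟨
      w + 2 * t ∸ 2 * t   ≡⟨ cong (_∸ 2 * t) w+2t≡2k ⟩
      2 * k ∸ 2 * t       ≡⟨ *-distribˡ-∸ 2 k t ⟨
      2 * (k ∸ t)         ∎

open ParityBall

module Doubling where

  open import Data.Nat as ℕ using (ℕ; zero; suc; _≤_; _<_; z≤n; s≤s)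
  import Data.Nat.Properties as ℕ
  open import Data.Integer as ℤ using (ℤ; +_; 0ℤ; 1ℤ; -1ℤ; _+_; _*_; _^_)
  import Data.Integer.Properties as ℤ
  open import Data.Integer.Tactic.RingSolver using (solve-∀)
  open import Data.List.Properties using (length-map; length-++; ++-conicalˡ)
  open import Relation.Nullary using (contradiction)
  open import Algebra.Properties.CommutativeSemigroup ℤ.*-commutativeSemigroup using (x∙yz≈y∙xz)
  open ≡-Reasoning

  private variable
    n : ℕ

  module _ {n} k (2k≤n : 2 ℕ.* k ≤ suc n) (C : List (Vec Bool (suc n)))
           (C-design : IsKKDesign k C) (|C| : length C ≡ binomSum (suc n) k) where

    private
      𝒜 = parityBall (suc n) k
      L = length C

      |𝒜|≡L : length 𝒜 ≡ L
      |𝒜|≡L = trans (length-parityBall n k) (sym |C|)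

      G : Vec Bool (suc n) → Vec Bool (suc n) → ℤ
      G x y = ∑ 𝒜 (λ A → χ A x * χ A y)

      fourier-⊕ : ∀ {A B} → A ∈ 𝒜 → B ∈ 𝒜 → B ≢ A → fourier C (A ⊕ B) ≡ 0ℤ
      fourier-⊕ {A} {B} A∈ B∈ B≢A with ⊕-parityBall A∈ B∈
      ... | zero  , w≡0  , _   = ⊥-elim (B≢A (sym (⊕-weight≡0⇒≡ A B w≡0)))
      ... | suc j , w≡2j , j≤k = IsKKDesign⇒fourier≡0 {C = C} C-design (A ⊕ B) w≡2j (s≤s z≤n) j≤k

      G*G : ∀ x y → G x y * G x y ≡ ∑ 𝒜 (λ A → ∑ 𝒜 (λ B → χ (A ⊕ B) x * χ (A ⊕ B) y))
      G*G x y = trans (∑-*-∑ 𝒜 𝒜 (λ A → χ A x * χ A y) (λ B → χ B x * χ B y))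
        (∑-cong {as = 𝒜} (λ {A} _ → ∑-cong {as = 𝒜} (λ {B} _ → begin
          (χ A x * χ A y) * (χ B x * χ B y) ≡⟨ interchange (χ A x) (χ A y) (χ B x) (χ B y) ⟩
          (χ A x * χ B x) * (χ A y * χ B y) ≡⟨ cong₂ _*_ (χ-⊕ˡ A B x) (χ-⊕ˡ A B y) ⟨
          χ (A ⊕ B) x * χ (A ⊕ B) y         ∎)))
        where
        interchange : ∀ p q r s → (p * q) * (r * s) ≡ (p * r) * (q * s)
        interchange = solve-∀

      ∑∑G*G≡L³ : ∑ C (λ x → ∑ C (λ y → G x y * G x y)) ≡ + (L ℕ.* (L ℕ.* L))
      ∑∑G*G≡L³ = begin
        ∑ C (λ x → ∑ C (λ y → G x y * G x y))
          ≡⟨ ∑-cong {as = C} (λ {x} _ → ∑-cong {as = C} (λ {y} _ → G*G x y)) ⟩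
        ∑ C (λ x → ∑ C (λ y → ∑ 𝒜 (λ A → F A x y)))
          ≡⟨ ∑-cong {as = C} (λ {x} _ → ∑-swap C 𝒜 (λ y A → F A x y)) ⟩
        ∑ C (λ x → ∑ 𝒜 (λ A → ∑ C (λ y → F A x y)))
          ≡⟨ ∑-swap C 𝒜 (λ x A → ∑ C (λ y → F A x y)) ⟩
        ∑ 𝒜 (λ A → ∑ C (λ x → ∑ C (λ y → F A x y)))
          ≡⟨ ∑-cong {as = 𝒜} (λ {A} _ → ∑∑χχ≡∑fourier² 𝒜 (A ⊕_) C) ⟩
        ∑ 𝒜 (λ A → ∑ 𝒜 (λ B → fourier C (A ⊕ B) * fourier C (A ⊕ B)))
          ≡⟨ ∑-cong {as = 𝒜} diagonal ⟩
        ∑ 𝒜 (λ _ → + L * + L)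
          ≡⟨ ∑-const 𝒜 (+ L * + L) ⟩
        + length 𝒜 * (+ L * + L)
          ≡⟨ cong₂ (λ a b → + a * b) |𝒜|≡L (sym (ℤ.pos-* L L)) ⟩
        + L * + (L ℕ.* L)
          ≡⟨ ℤ.pos-* L (L ℕ.* L) ⟨
        + (L ℕ.* (L ℕ.* L)) ∎
        where
        F : Vec Bool (suc n) → Vec Bool (suc n) → Vec Bool (suc n) → ℤ
        F A x y = ∑ 𝒜 (λ B → χ (A ⊕ B) x * χ (A ⊕ B) y)
        diagonal : ∀ {A} → A ∈ 𝒜 → ∑ 𝒜 (λ B → fourier C (A ⊕ B) * fourier C (A ⊕ B)) ≡ + L * + L
        diagonal {A} A∈ = begin
          ∑ 𝒜 (λ B → fourier C (A ⊕ B) * fourier C (A ⊕ B))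
            ≡⟨ ∑-unique-support (parityBall-unique (suc n) k) A∈
                 (λ B∈ B≢A → cong (λ f → f * fourier C (A ⊕ _)) (fourier-⊕ A∈ B∈ B≢A)) ⟩
          fourier C (A ⊕ A) * fourier C (A ⊕ A)
            ≡⟨ cong (λ f → f * f) (trans (cong (fourier C) (⊕-self A)) (fourier-zeros C)) ⟩
          + L * + L ∎

      ∣G-diagonal∣² : ∀ x → ∣ G x x ∣² ≡ L ℕ.* L
      ∣G-diagonal∣² x = ℤ.+-injective (begin
        + ∣ G x x ∣²   ≡⟨ i*i≡∣i∣² (G x x) ⟨
        G x x * G x x  ≡⟨ cong (λ g → g * g) G-diagonal ⟩
        + L * + L      ≡⟨ ℤ.pos-* L L ⟨
        + (L ℕ.* L)    ∎)
        where
        G-diagonal : G x x ≡ + L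
        G-diagonal = begin
          ∑ 𝒜 (λ A → χ A x * χ A x)  ≡⟨ ∑-cong {as = 𝒜} (λ {A} _ → χ-square A x) ⟩
          ∑ 𝒜 (λ _ → 1ℤ)             ≡⟨ ∑-const 𝒜 1ℤ ⟩
          + length 𝒜 * 1ℤ            ≡⟨ ℤ.*-identityʳ _ ⟩
          + length 𝒜                 ≡⟨ cong +_ |𝒜|≡L ⟩
          + L                        ∎

      ∣G-antipodal∣² : ∀ x → ∣ G x (complement x) ∣² ≡ L ℕ.* L
      ∣G-antipodal∣² x = ℤ.+-injective (begin
        + ∣ G x x̄ ∣²                      ≡⟨ i*i≡∣i∣² (G x x̄) ⟨
        G x x̄ * G x x̄                     ≡⟨ cong (λ g → g * g) G-antipodal ⟩
        (+ L * -1ℤ ^ k) * (+ L * -1ℤ ^ k)  ≡⟨ interchange (+ L) (-1ℤ ^ k) ⟩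
        (+ L * + L) * (-1ℤ ^ k * -1ℤ ^ k)  ≡⟨ cong (λ s → (+ L * + L) * s) (-1^j*-1^j≡1 k) ⟩
        (+ L * + L) * 1ℤ                  ≡⟨ ℤ.*-identityʳ _ ⟩
        + L * + L                         ≡⟨ ℤ.pos-* L L ⟨
        + (L ℕ.* L)                       ∎)
        where
        x̄ = complement x
        interchange : ∀ l s → (l * s) * (l * s) ≡ (l * l) * (s * s)
        interchange = solve-∀
        same-sign : ∀ {A} → A ∈ 𝒜 → χ A x * χ A x̄ ≡ -1ℤ ^ k
        same-sign {A} A∈ with ∈-parityBall⇒ k A∈
        ... | j , w+2j≡k = begin
          χ A x * χ A x̄                     ≡⟨ cong (χ A x *_) (χ-complement A x) ⟩
          χ A x * (-1ℤ ^ weight A * χ A x)  ≡⟨ x∙yz≈y∙xz (χ A x) (-1ℤ ^ weight A) (χ A x) ⟩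
          -1ℤ ^ weight A * (χ A x * χ A x)  ≡⟨ cong (λ s → -1ℤ ^ weight A * s) (χ-square A x) ⟩
          -1ℤ ^ weight A * 1ℤ               ≡⟨ ℤ.*-identityʳ _ ⟩
          -1ℤ ^ weight A                    ≡⟨ -1^[w+2j]≡-1^w (weight A) j ⟨
          -1ℤ ^ (weight A ℕ.+ 2 ℕ.* j)      ≡⟨ cong (-1ℤ ^_) w+2j≡k ⟩
          -1ℤ ^ k                           ∎
        G-antipodal : G x x̄ ≡ + L * -1ℤ ^ k
        G-antipodal = begin
          ∑ 𝒜 (λ A → χ A x * χ A x̄)  ≡⟨ ∑-cong {as = 𝒜} same-sign ⟩
          ∑ 𝒜 (λ _ → -1ℤ ^ k)        ≡⟨ ∑-const 𝒜 (-1ℤ ^ k) ⟩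
          + length 𝒜 * -1ℤ ^ k       ≡⟨ cong (λ a → + a * -1ℤ ^ k) |𝒜|≡L ⟩
          + L * -1ℤ ^ k              ∎

      row : Vec Bool (suc n) → ℕ
      row x = ∑ℕ C (λ y → ∣ G x y ∣²)

      ∑row≡L³ : ∑ℕ C row ≡ L ℕ.* (L ℕ.* L)
      ∑row≡L³ = ℤ.+-injective (begin
        + ∑ℕ C row
          ≡⟨ pos-∑ℕ C row ⟩
        ∑ C (λ x → + row x)
          ≡⟨ ∑-cong {as = C} (λ {x} _ → pos-∑ℕ C (λ y → ∣ G x y ∣²)) ⟩
        ∑ C (λ x → ∑ C (λ y → + ∣ G x y ∣²))
          ≡⟨ ∑-cong {as = C} (λ {x} _ → ∑-cong {as = C} (λ {y} _ → i*i≡∣i∣² (G x y))) ⟨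
        ∑ C (λ x → ∑ C (λ y → G x y * G x y))
          ≡⟨ ∑∑G*G≡L³ ⟩
        + (L ℕ.* (L ℕ.* L)) ∎)

    noAntipodalPair : ∀ {x} → x ∈ C → complement x ∈ C → ⊥
    noAntipodalPair {x} x∈ x̄∈ = ℕ.<-irrefl refl (subst₂ _<_ (∑ℕ-const C (L ℕ.* L)) ∑row≡L³ L³<∑row)
      where
      diagonal≤row : ∀ {y} → y ∈ C → L ℕ.* L ≤ row y
      diagonal≤row {y} y∈ = subst (_≤ row y) (∣G-diagonal∣² y) (∈⇒≤∑ℕ (λ z → ∣ G y z ∣²) y∈)
      L>0 : ∀ {xs : List (Vec Bool (suc n))} → x ∈ xs → 0 < length xs
      L>0 (here _)  = s≤s z≤n
      L>0 (there _) = s≤s z≤n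
      L²<row : L ℕ.* L < row x
      L²<row = ℕ.<-≤-trans (ℕ.m<m+n (L ℕ.* L) (ℕ.*-mono-< (L>0 x∈) (L>0 x∈)))
        (subst (_≤ row x) (cong₂ ℕ._+_ (∣G-diagonal∣² x) (∣G-antipodal∣² x))
               (∈-distinct⇒≤∑ℕ (λ y → ∣ G x y ∣²) x∈ x̄∈ (≢-complement x)))
      L³<∑row : ∑ℕ C (λ _ → L ℕ.* L) < ∑ℕ C row
      L³<∑row = ∑ℕ-mono-< (λ _ → L ℕ.* L) row diagonal≤row x∈ L²<row

  double : List (Vec Bool n) → List (Vec Bool n)
  double C = C ++ map complement C

  fourier-double : ∀ (C : List (Vec Bool n)) S →
                   fourier (double C) S ≡ fourier C S + -1ℤ ^ weight S * fourier C S
  fourier-double C S = begin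
    ∑ (C ++ map complement C) (χ S)             ≡⟨ ∑-++ C (map complement C) (χ S) ⟩
    fourier C S + ∑ (map complement C) (χ S)    ≡⟨ cong (λ f → fourier C S + f) fourier-complement ⟩
    fourier C S + -1ℤ ^ weight S * fourier C S  ∎
    where
    fourier-complement : ∑ (map complement C) (χ S) ≡ -1ℤ ^ weight S * fourier C S
    fourier-complement = begin
      ∑ (map complement C) (χ S)          ≡⟨ ∑-map complement C (χ S) ⟩
      ∑ C (λ x → χ S (complement x))      ≡⟨ ∑-cong {as = C} (λ {x} _ → χ-complement S x) ⟩
      ∑ C (λ x → -1ℤ ^ weight S * χ S x)  ≡⟨ ∑-*ˡ C (-1ℤ ^ weight S) (χ S) ⟩
      -1ℤ ^ weight S * fourier C S        ∎

  double-unique : ∀ {C : List (Vec Bool n)} → Unique C → (∀ {x} → x ∈ C → complement x ∈ C → ⊥) →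
                  Unique (double C)
  double-unique {C = C} C-unique no-antipodes =
    Unique.++⁺ C-unique (Unique.map⁺ complement-injective C-unique) disjoint
    where
    disjoint : ∀ {v} → ¬ (v ∈ C × v ∈ map complement C)
    disjoint (v∈ , v∈map) with ∈-map⁻ complement v∈map
    ... | x , x∈ , refl = no-antipodes x∈ v∈

  length-double : ∀ (C : List (Vec Bool n)) → length (double C) ≡ 2 ℕ.* length C
  length-double C = begin
    length (C ++ map complement C)           ≡⟨ length-++ C ⟩
    length C ℕ.+ length (map complement C)   ≡⟨ cong (length C ℕ.+_) (length-map complement C) ⟩
    length C ℕ.+ length C                    ≡⟨ cong (length C ℕ.+_) (ℕ.+-identityʳ _) ⟨
    2 ℕ.* length C                           ∎

  even-or-odd : ∀ m → ∃[ j ] (m ≡ 2 ℕ.* j ⊎ m ≡ suc (2 ℕ.* j))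
  even-or-odd zero    = 0 , inj₁ refl
  even-or-odd (suc m) with even-or-odd m
  ... | j , inj₁ m≡2j   = j , inj₂ (cong suc m≡2j)
  ... | j , inj₂ m≡1+2j = suc j , inj₁ (trans (cong suc m≡1+2j) (sym (ℕ.*-suc 2 j)))

  double-IsDesign : ∀ .{{_ : ℕ.NonZero n}} {k} {C : List (Vec Bool n)} → 2 ℕ.* k ≤ n →
                    IsKKDesign k C → IsDesign (suc (2 ℕ.* k)) (double C)
  double-IsDesign {k = k} {C} 2k≤n C-design = fourier≡0⇒IsDesign {C = double C} vanish
    where
    vanish : ∀ S → 1 ≤ weight S → weight S ≤ suc (2 ℕ.* k) → fourier (double C) S ≡ 0ℤ
    vanish S 1≤w w≤1+2k with even-or-odd (weight S)
    ... | zero  , inj₁ w≡0  = contradiction (subst (1 ≤_) w≡0 1≤w) λ ()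
    ... | suc j , inj₁ w≡2j = begin
      fourier (double C) S                        ≡⟨ fourier-double C S ⟩
      fourier C S + -1ℤ ^ weight S * fourier C S  ≡⟨ cong (λ f → f + -1ℤ ^ weight S * f) F≡0 ⟩
      0ℤ + -1ℤ ^ weight S * 0ℤ                    ≡⟨ cong (λ f → 0ℤ + f) (ℤ.*-zeroʳ (-1ℤ ^ weight S)) ⟩
      0ℤ                                          ∎
      where
      2j<2[1+k] : 2 ℕ.* suc j < 2 ℕ.* suc k
      2j<2[1+k] = subst (suc (2 ℕ.* suc j) ≤_) (sym (ℕ.*-suc 2 k))
                        (s≤s (subst (_≤ suc (2 ℕ.* k)) w≡2j w≤1+2k))
      F≡0 : fourier C S ≡ 0ℤ
      F≡0 = IsKKDesign⇒fourier≡0 {C = C} C-design S w≡2j (s≤s z≤n)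
                                 (ℕ.≤-pred (ℕ.*-cancelˡ-< 2 (suc j) (suc k) 2j<2[1+k]))
    ... | j , inj₂ w≡1+2j = begin
      fourier (double C) S                        ≡⟨ fourier-double C S ⟩
      fourier C S + -1ℤ ^ weight S * fourier C S  ≡⟨ cong (λ s → fourier C S + s * fourier C S) -1^w≡-1 ⟩
      fourier C S + -1ℤ * fourier C S             ≡⟨ cancel (fourier C S) ⟩
      0ℤ                                          ∎
      where
      -1^w≡-1 : -1ℤ ^ weight S ≡ -1ℤ
      -1^w≡-1 = trans (cong (-1ℤ ^_) w≡1+2j) (cong (-1ℤ *_) (-1^[w+2j]≡-1^w 0 j))
      cancel : ∀ f → f + -1ℤ * f ≡ 0ℤ
      cancel = solve-∀

  double-tight : ∀ {n} k → 2 ℕ.* k ≤ suc n → (C : List (Vec Bool (suc n))) →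
                 TightKKDesign k C → TightOddDesign k (double C)
  double-tight k 2k≤n C ((C-unique , C≢[]) , C-design , |C|) =
    ( double-unique C-unique (noAntipodalPair k 2k≤n C C-design |C|)
    , λ double≡[] → C≢[] (++-conicalˡ C (map complement C) double≡[]) )
    , double-IsDesign {C = C} 2k≤n C-design
    , trans (length-double C) (cong (2 ℕ.*_) |C|)

open import Data.Nat using (ℕ; suc; _≤_; _*_; s≤s; z≤n)
open Shortening using (zeroHeaded; zeroHeaded-tight)
open Doubling using (double; double-tight)

-- The constructions also work for k = 0.
theorem5p1 : ∀ (n k : ℕ) → 1 ≤ n → 1 ≤ k → 2 * k ≤ n →
    ((Σ (List (Vec Bool n)) λ C → TightKKDesign k C) → (Σ (List (Vec Bool n)) λ C → TightOddDesign k C))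
    × ((Σ (List (Vec Bool n)) λ C → TightOddDesign k C) → (Σ (List (Vec Bool n)) λ C → TightKKDesign k C))
theorem5p1 (suc n) k (s≤s z≤n) _ 2k≤n =
  (λ (C , tight) → double C , double-tight k 2k≤n C tight) ,
  (λ (D , tight) → zeroHeaded D , zeroHeaded-tight k 2k≤n D tight)
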